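{- Let $X=\mathcal{M}_O(n,a,b)$ be feasible with $a>1$, and suppose the edge $[v_0,v_a]$ lies in $\mathcal{G}$. Then $X$ admits an automorphism fixing $u_0$ and cyclically permuting the sets $\mathcal{R},\mathcal{B},\mathcal{G}$ if and only if $n\equiv 8\pmod{16}$, $b=4b_0+1$ with $n/2<b<(3n-4)/4$, where $b_0$ is odd and $8(b_0^2+b_0+1)\equiv 0\pmod n$, and $a=b-n/2+2$.
   Context: For even $n\ge4$ and odd $0<a<b<n$, $\mathcal{M}_O(n,a,b)$ has vertices $u_0,\dots,u_{n-1},v_0,\dots,v_{n-1}$ and edges $[u_i,u_{i+1}]$, $[u_i,v_i]$ for all $i$ and $[v_i,v_{i+a}]$, $[v_i,v_{i+b}]$ for even $i$ (subscripts mod $n$). It is feasible if $\gcd(b-a,n)=2$, $(b-a)^2/2\equiv 2\pmod n$, at least one of $a+(a-1)(a-b)/2\equiv1$ or $b+(b-1)(b-a)/2\equiv 1\pmod n$ holds, and $1\le a<b-2<n-a-2$. Let $x=a$ if $a+(a-1)(a-b)/2\equiv 1\pmod n$ and $x=b$ otherwise, and $y$ the other element of $\{a,b\}$. $\mathcal{R}=\{[u_i,v_i]\}$; $\mathcal{B}=\{[u_i,u_{i+1}]: i\text{ even}\}\cup\{[v_j,v_{j+x}]: j\text{ even}\}$; $\mathcal{G}=\{[u_i,u_{i+1}]: i\text{ odd}\}\cup\{[v_j,v_{j+y}]: j\text{ even}\}$. -}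

module Defs where

open import Data.Nat using (ℕ; zero; suc; _+_; _*_; _∸_; _^_; _≤_; _<_; NonZero)
open import Data.Nat.DivMod using (_%_; _/_; m%n<n)
open import Data.Nat.GCD using (gcd)
open import Data.Fin using (Fin; fromℕ<)
open import Data.Integer as ℤ using (ℤ; +_)
open import Data.Integer.Divisibility as ℤD using ()
open import Data.Product using (Σ; _×_)
open import Data.Sum using (_⊎_)
open import Relation.Nullary using (¬_)
open import Relation.Binary.PropositionalEquality using (_≡_)
open import Function.Bundles using (_↔_; _⇔_; Inverse)

data V (n : ℕ) : Set where
  u : Fin n → V n
  v : Fin n → V n

ι : (n : ℕ) .{{_ : NonZero n}} → ℕ → Fin n
ι n k = fromℕ< (m%n<n k n)

U : (n : ℕ) .{{_ : NonZero n}} → ℕ → V n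
U n k = u (ι n k)

W : (n : ℕ) .{{_ : NonZero n}} → ℕ → V n
W n k = v (ι n k)

-- symmetric closure: edges are unordered pairs
Sym : ∀ {n} → (V n → V n → Set) → V n → V n → Set
Sym R x y = R x y ⊎ R y x

SpokeArc : (n : ℕ) .{{_ : NonZero n}} → V n → V n → Set
SpokeArc n x y = Σ ℕ λ i → i < n × x ≡ U n i × y ≡ W n i

-- [u_i , u_{i+1}] with i ≡ p (mod 2)   (n is even, so parity of i ∈ ℤ_n is well defined)
RimArc : (n : ℕ) .{{_ : NonZero n}} → ℕ → V n → V n → Set
RimArc n p x y = Σ ℕ λ i → i < n × i % 2 ≡ p × x ≡ U n i × y ≡ U n (i + 1)

RimArcAll : (n : ℕ) .{{_ : NonZero n}} → V n → V n → Set
RimArcAll n x y = Σ ℕ λ i → i < n × x ≡ U n i × y ≡ U n (i + 1)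

ChordArc : (n : ℕ) .{{_ : NonZero n}} → ℕ → V n → V n → Set
ChordArc n s x y = Σ ℕ λ j → j < n × j % 2 ≡ 0 × x ≡ W n j × y ≡ W n (j + s)

Adj : (n : ℕ) .{{_ : NonZero n}} → ℕ → ℕ → V n → V n → Set
Adj n a b = Sym (λ x y → RimArcAll n x y ⊎ SpokeArc n x y ⊎ ChordArc n a x y ⊎ ChordArc n b x y)

-- d = (b - a)/2   (b - a is even since a, b are odd)
half : ℕ → ℕ → ℕ
half a b = (b ∸ a) / 2

-- a + (a-1)(a-b)/2 ≡ 1 (mod n), computed in ℤ; (a-1)(a-b)/2 = -(a-1)·d
CondA : ℕ → ℕ → ℕ → Set
CondA n a b = (+ n) ℤD.∣ ((+ a ℤ.- + ((a ∸ 1) * half a b)) ℤ.- + 1)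

-- b + (b-1)(b-a)/2 ≡ 1 (mod n), computed in ℤ; (b-1)(b-a)/2 = (b-1)·d
CondB : ℕ → ℕ → ℕ → Set
CondB n a b = (+ n) ℤD.∣ ((+ b ℤ.+ + ((b ∸ 1) * half a b)) ℤ.- + 1)

Feasible : (n : ℕ) .{{_ : NonZero n}} → ℕ → ℕ → Set
Feasible n a b =
  n % 2 ≡ 0 × 4 ≤ n ×
  a % 2 ≡ 1 × b % 2 ≡ 1 × 0 < a × a < b × b < n ×
  gcd (b ∸ a) n ≡ 2 ×
  ((b ∸ a) ^ 2 / 2) % n ≡ 2 % n ×
  (CondA n a b ⊎ CondB n a b) ×
  1 ≤ a × a < b ∸ 2 × b ∸ 2 < n ∸ a ∸ 2

-- colour classes.  x = a if CondA, x = b otherwise; y = the other one.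
Rset : (n : ℕ) .{{_ : NonZero n}} → V n → V n → Set
Rset n = Sym (SpokeArc n)

Bset : (n : ℕ) .{{_ : NonZero n}} → ℕ → ℕ → V n → V n → Set
Bset n a b = Sym (λ x y → RimArc n 0 x y ⊎
                   ((CondA n a b × ChordArc n a x y) ⊎ (¬ CondA n a b × ChordArc n b x y)))

Gset : (n : ℕ) .{{_ : NonZero n}} → ℕ → ℕ → V n → V n → Set
Gset n a b = Sym (λ x y → RimArc n 1 x y ⊎
                   ((CondA n a b × ChordArc n b x y) ⊎ (¬ CondA n a b × ChordArc n a x y)))

MapsOnto : ∀ {n} → (V n → V n) → (V n → V n → Set) → (V n → V n → Set) → Set
MapsOnto f P Q = ∀ x y → P x y ⇔ Q (f x) (f y)

IsAut : (n : ℕ) .{{_ : NonZero n}} → ℕ → ℕ → (V n ↔ V n) → Set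
IsAut n a b φ = ∀ x y → Adj n a b x y ⇔ Adj n a b (Inverse.to φ x) (Inverse.to φ y)

CyclicAut : (n : ℕ) .{{_ : NonZero n}} → ℕ → ℕ → (V n ↔ V n) → Set
CyclicAut n a b φ =
  IsAut n a b φ × Inverse.to φ (U n 0) ≡ U n 0 ×
  ((MapsOnto f (Rset n) (Bset n a b) × MapsOnto f (Bset n a b) (Gset n a b) × MapsOnto f (Gset n a b) (Rset n))
   ⊎ (MapsOnto f (Rset n) (Gset n a b) × MapsOnto f (Gset n a b) (Bset n a b) × MapsOnto f (Bset n a b) (Rset n)))
  where f = Inverse.to φ

-- Each colour class is a perfect matching, i.e. the graph of an involution: the spokes, blue
-- (even rim edges and the chords of length b) and green (odd rim edges and the chords of length a);
-- [v₀, v_a] ∈ G forces x = b.  An automorphism fixing u₀ and cycling R → G → B → R is a map f with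
-- f ∘ spoke = green ∘ f, f ∘ blue = spoke ∘ f, f ∘ green = blue ∘ f (the other cyclic order is
-- handled by the inverse).  Along the rim the edges alternate blue and green, which forces
-- f(u_{4K}) = u_{Kc}, f(u_{4K+1}) = v_{Kc}, f(u_{4K+2}) = v_{Kc+b}, f(u_{4K+3}) = u_{Kc+b} with
-- c = b − 1, and f(v_z) = green (f(u_z)).  Following the chords at v₀ and v₂ then forces b = 4β + 1,
-- a = 4α − 1 and n ∣ 4(β² + α), 4(αβ + 1), 8(β − α + 1).  Conversely, under these congruences the
-- formula is well defined and satisfies the three laws, and f³ = id because a map commuting with
-- the three involutions and fixing u₀ fixes the whole connected graph.  Elementary arithmetic,
-- using b + a < n, turns the congruences into the stated conditions: n = 8(β − α + 1) with
-- β − α + 1 odd, b₀ = β, and a = b + 2 − n/2.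

module Submission where

open import Defs

module Congruences where

  open import Data.Nat as ℕ using (ℕ; suc; NonZero)
  import Data.Nat.DivMod as ℕD
  import Data.Nat.Divisibility as ℕ∣
  open import Data.Integer using (ℤ; +_; -[1+_]; 0ℤ; 1ℤ; -1ℤ; _+_; _*_; _-_; -_; _%ℕ_; _/ℕ_)
  import Data.Integer.Properties as ℤP
  open import Data.Integer.DivMod using (n%ℕd<d; a≡a%ℕn+[a/ℕn]*n)
  open import Data.Integer.Divisibility.Signed
    using (_∣_; divides; ∣-refl; ∣-trans; ∣m∣n⇒∣m+n; ∣m⇒∣-m; ∣n⇒∣m*n; ∣ᵤ⇒∣)
  open import Data.Integer.Tactic.RingSolver using (solve-∀)
  open import Data.Sum using (_⊎_; inj₁; inj₂)
  open import Data.Empty using (⊥; ⊥-elim)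
  open import Relation.Binary.PropositionalEquality
    using (_≡_; refl; sym; trans; cong; subst; module ≡-Reasoning)

  infix 4 _≡_mod_

  record _≡_mod_ (x y : ℤ) (m : ℕ) : Set where
    constructor by-divisibility
    field divides-difference : + m ∣ x - y

  ∣-combination : ∀ {k e e₁ e₂} c₁ c₂ → k ∣ e₁ → k ∣ e₂ → e ≡ c₁ * e₁ + c₂ * e₂ → k ∣ e
  ∣-combination {k} c₁ c₂ k∣e₁ k∣e₂ eq =
    subst (k ∣_) (sym eq) (∣m∣n⇒∣m+n (∣n⇒∣m*n c₁ k∣e₁) (∣n⇒∣m*n c₂ k∣e₂))

  module _ {m : ℕ} where

    mod-by-divisibility : ∀ {x y e} → x - y ≡ e → + m ∣ e → x ≡ y mod m
    mod-by-divisibility eq m∣e = by-divisibility (subst (+ m ∣_) (sym eq) m∣e)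

    mod-by-combination : ∀ {x y e₁ e₂} c₁ c₂ → + m ∣ e₁ → + m ∣ e₂ →
                         x - y ≡ c₁ * e₁ + c₂ * e₂ → x ≡ y mod m
    mod-by-combination c₁ c₂ m∣e₁ m∣e₂ eq = mod-by-divisibility eq (∣-combination c₁ c₂ m∣e₁ m∣e₂ refl)

    mod-by-multiple : ∀ {x y e} c → + m ∣ e → x - y ≡ c * e → x ≡ y mod m
    mod-by-multiple c m∣e eq = mod-by-divisibility eq (∣n⇒∣m*n c m∣e)

    mod-reflexive : ∀ {x y} → x ≡ y → x ≡ y mod m
    mod-reflexive {x} refl = by-divisibility (divides 0ℤ (ℤP.+-inverseʳ x))

    mod-refl : ∀ {x} → x ≡ x mod m
    mod-refl = mod-reflexive refl

    mod-sym : ∀ {x y} → x ≡ y mod m → y ≡ x mod m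
    mod-sym {x} {y} (by-divisibility m∣x-y) = mod-by-divisibility (swap x y) (∣m⇒∣-m m∣x-y)
      where
      swap : ∀ x y → y - x ≡ - (x - y)
      swap = solve-∀

    mod-trans : ∀ {x y z} → x ≡ y mod m → y ≡ z mod m → x ≡ z mod m
    mod-trans {x} {y} {z} (by-divisibility p) (by-divisibility q) =
      mod-by-divisibility (telescope x y z) (∣m∣n⇒∣m+n p q)
      where
      telescope : ∀ x y z → x - z ≡ (x - y) + (y - z)
      telescope = solve-∀

    +-cong-mod : ∀ {x x′ y y′} → x ≡ x′ mod m → y ≡ y′ mod m → x + y ≡ x′ + y′ mod m
    +-cong-mod {x} {x′} {y} {y′} (by-divisibility p) (by-divisibility q) =
      mod-by-divisibility (regroup x x′ y y′) (∣m∣n⇒∣m+n p q)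
      where
      regroup : ∀ x x′ y y′ → (x + y) - (x′ + y′) ≡ (x - x′) + (y - y′)
      regroup = solve-∀

    neg-cong-mod : ∀ {x y} → x ≡ y mod m → - x ≡ - y mod m
    neg-cong-mod {x} {y} (by-divisibility p) = mod-by-divisibility (negate x y) (∣m⇒∣-m p)
      where
      negate : ∀ x y → - x - - y ≡ - (x - y)
      negate = solve-∀

    *-congˡ-mod : ∀ c {x y} → x ≡ y mod m → c * x ≡ c * y mod m
    *-congˡ-mod c {x} {y} (by-divisibility p) = mod-by-divisibility (distrib c x y) (∣n⇒∣m*n c p)
      where
      distrib : ∀ c x y → c * x - c * y ≡ c * (x - y)
      distrib = solve-∀

    mod-self : + m ≡ 0ℤ mod m
    mod-self = mod-by-multiple 1ℤ ∣-refl (identity (+ m))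
      where
      identity : ∀ m → m - 0ℤ ≡ 1ℤ * m
      identity = solve-∀

    mod-weaken : ∀ {d x y} → + d ∣ + m → x ≡ y mod m → x ≡ y mod d
    mod-weaken d∣m (by-divisibility p) = by-divisibility (∣-trans d∣m p)

  module _ {m : ℕ} .{{_ : NonZero m}} where

    %ℕ-mod : ∀ z → + (z %ℕ m) ≡ z mod m
    %ℕ-mod z = by-divisibility (divides (- (z /ℕ m)) (begin
      + (z %ℕ m) - z                           ≡⟨ cong (λ w → + (z %ℕ m) - w) (a≡a%ℕn+[a/ℕn]*n z m) ⟩
      + (z %ℕ m) - (+ (z %ℕ m) + z /ℕ m * + m) ≡⟨ cancel (+ (z %ℕ m)) (z /ℕ m) (+ m) ⟩
      - (z /ℕ m) * + m                         ∎))
      where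
      open ≡-Reasoning
      cancel : ∀ r q M → r - (r + q * M) ≡ - q * M
      cancel = solve-∀

    residue-unique-by : ∀ {r s} → r ℕ.< m → s ℕ.< m → ∀ k → + r - + s ≡ + k * + m → r ≡ s
    residue-unique-by {r} {s} r<m s<m k eq = begin
      r                     ≡⟨ ℕD.m<n⇒m%n≡m r<m ⟨
      r ℕ.% m               ≡⟨ cong (ℕ._% m) r≡s+km ⟩
      (s ℕ.+ k ℕ.* m) ℕ.% m ≡⟨ ℕD.[m+kn]%n≡m%n s k m ⟩
      s ℕ.% m               ≡⟨ ℕD.m<n⇒m%n≡m s<m ⟩
      s                     ∎
      where
      open ≡-Reasoning
      shift : ∀ r s → r ≡ s + (r - s)
      shift = solve-∀
      r≡s+km : r ≡ s ℕ.+ k ℕ.* m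
      r≡s+km = ℤP.+-injective (begin
        + r                 ≡⟨ shift (+ r) (+ s) ⟩
        + s + (+ r - + s)   ≡⟨ cong (_+_ (+ s)) eq ⟩
        + s + + k * + m     ≡⟨ cong (_+_ (+ s)) (ℤP.pos-* k m) ⟨
        + s + + (k ℕ.* m)   ≡⟨ ℤP.pos-+ s (k ℕ.* m) ⟨
        + (s ℕ.+ k ℕ.* m)   ∎)

    residue-unique : ∀ {r s} → r ℕ.< m → s ℕ.< m → + r ≡ + s mod m → r ≡ s
    residue-unique r<m s<m (by-divisibility (divides (+ k) eq)) = residue-unique-by r<m s<m k eq
    residue-unique {r} {s} r<m s<m (by-divisibility (divides -[1+ k ] eq)) =
      sym (residue-unique-by s<m r<m (suc k) (negate (+ r) (+ s) (+ suc k) (+ m) eq))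
      where
      negate : ∀ r s k m → r - s ≡ - k * m → s - r ≡ k * m
      negate r s k m eq = trans (swap r s) (trans (cong -_ eq) (unswap k m))
        where
        swap : ∀ r s → s - r ≡ - (r - s)
        swap = solve-∀
        unswap : ∀ k m → - (- k * m) ≡ k * m
        unswap = solve-∀

    mod⇒%ℕ≡ : ∀ {x y} → x ≡ y mod m → x %ℕ m ≡ y %ℕ m
    mod⇒%ℕ≡ {x} {y} x≡y = residue-unique (n%ℕd<d x m) (n%ℕd<d y m)
      (mod-trans (%ℕ-mod x) (mod-trans x≡y (mod-sym (%ℕ-mod y))))

    %ℕ≡⇒mod : ∀ {x y} → x %ℕ m ≡ y %ℕ m → x ≡ y mod m
    %ℕ≡⇒mod {x} {y} eq = mod-trans (mod-sym (%ℕ-mod x)) (subst (λ r → + r ≡ y mod m) (sym eq) (%ℕ-mod y))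

  Even Odd : ℤ → Set
  Even z = z ≡ 0ℤ mod 2
  Odd z = z ≡ 1ℤ mod 2

  even-or-odd : ∀ z → Even z ⊎ Odd z
  even-or-odd z with z %ℕ 2 | n%ℕd<d z 2 | %ℕ-mod {2} z
  ... | 0 | _ | r = inj₁ (mod-sym r)
  ... | 1 | _ | r = inj₂ (mod-sym r)
  ... | suc (suc _) | ℕ.s≤s (ℕ.s≤s ()) | _

  even⇒¬odd : ∀ {z} → Even z → Odd z → ⊥
  even⇒¬odd e o with trans (sym (mod⇒%ℕ≡ e)) (mod⇒%ℕ≡ o)
  ... | ()

  even+odd : ∀ {x y} → Even x → Odd y → Odd (x + y)
  even+odd = +-cong-mod

  odd+odd : ∀ {x y} → Odd x → Odd y → Even (x + y)
  odd+odd o o′ = mod-trans (+-cong-mod o o′) mod-self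

  neg-odd : ∀ {x} → Odd x → Odd (- x)
  neg-odd o = mod-trans (neg-cong-mod o) (mod-by-multiple -1ℤ ∣-refl refl)

  *-even : ∀ c {x} → Even x → Even (c * x)
  *-even c e = mod-trans (*-congˡ-mod c e) (mod-reflexive (ℤP.*-zeroʳ c))

  odd*odd : ∀ {x y} → Odd x → Odd y → Odd (x * y)
  odd*odd {x} {y} o o′ = mod-trans (*-congˡ-mod x o′) (mod-trans (mod-reflexive (ℤP.*-identityʳ x)) o)

  odd-factorˡ : ∀ {x y} → Odd (x * y) → Odd x
  odd-factorˡ {x} {y} o with even-or-odd x
  ... | inj₂ x-odd = x-odd
  ... | inj₁ x-even = ⊥-elim (even⇒¬odd (subst Even (ℤP.*-comm y x) (*-even y x-even)) o)

  %2≡0⇒2∣ : ∀ {n} → n ℕ.% 2 ≡ 0 → + 2 ∣ + n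
  %2≡0⇒2∣ {n} n%2≡0 = ∣ᵤ⇒∣ (ℕ∣.m%n≡0⇒n∣m n 2 n%2≡0)

  mod⇒∣ : ∀ {m x y e} → x ≡ y mod m → x - y ≡ e → + m ∣ e
  mod⇒∣ {m} (by-divisibility m∣x-y) eq = subst (+ m ∣_) eq m∣x-y

  odd-factorʳ : ∀ {x y} → Odd (x * y) → Odd y
  odd-factorʳ {x} {y} o = odd-factorˡ (subst Odd (ℤP.*-comm x y) o)

  even-suc⇒odd : ∀ {x} → Even (x + 1ℤ) → Odd x
  even-suc⇒odd {x} e = subst Odd (cancel x) (even+odd e (neg-odd mod-refl))
    where
    cancel : ∀ x → x + 1ℤ + - 1ℤ ≡ x
    cancel = solve-∀

module ColouredPrism where

  open import Data.Nat as ℕ using (ℕ; zero; suc; NonZero)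
  import Data.Nat.Properties as ℕP
  import Data.Nat.DivMod as ℕD
  open import Data.Integer using (ℤ; +_; 0ℤ; 1ℤ; -1ℤ; _+_; _-_; -_; _%ℕ_)
  open import Data.Integer.DivMod using (n%ℕd<d)
  open import Data.Integer.Divisibility.Signed using (_∣_)
  open import Data.Integer.Tactic.RingSolver using (solve-∀)
  open import Data.Fin using (Fin; toℕ; fromℕ<)
  import Data.Fin.Properties as FinP
  open import Data.Product using (Σ; _×_; _,_)
  open import Data.Sum using (_⊎_; inj₁; inj₂)
  open import Data.Empty using (⊥-elim)
  open import Relation.Nullary using (¬_)
  open import Relation.Binary.PropositionalEquality
    using (_≡_; refl; sym; trans; cong; subst; subst₂; module ≡-Reasoning)
  open import Function.Bundles using (_⇔_; mk⇔; _↔_; Inverse; mk↔ₛ′; Equivalence)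
  import Function.Properties.Equivalence as ⇔
  open Congruences

  signed : ℕ → ℤ → ℤ
  signed zero s = s
  signed (suc _) s = - s

  alternateℤ : ℤ → ℤ → ℤ
  alternateℤ s z = z + signed (z %ℕ 2) s

  alternateℤ-even : ∀ s {z} → Even z → alternateℤ s z ≡ z + s
  alternateℤ-even s {z} e = cong (λ r → z + signed r s) (mod⇒%ℕ≡ e)

  alternateℤ-odd : ∀ s {z} → Odd z → alternateℤ s z ≡ z - s
  alternateℤ-odd s {z} o = cong (λ r → z + signed r s) (mod⇒%ℕ≡ o)

  alternateℤ-involutive : ∀ {s} → Odd s → ∀ z → alternateℤ s (alternateℤ s z) ≡ z
  alternateℤ-involutive {s} s-odd z with even-or-odd z
  ... | inj₁ e = begin
    alternateℤ s (alternateℤ s z) ≡⟨ cong (alternateℤ s) (alternateℤ-even s e) ⟩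
    alternateℤ s (z + s)          ≡⟨ alternateℤ-odd s (even+odd e s-odd) ⟩
    z + s - s                     ≡⟨ cancel z s ⟩
    z                             ∎
    where
    open ≡-Reasoning
    cancel : ∀ z s → z + s - s ≡ z
    cancel = solve-∀
  ... | inj₂ o = begin
    alternateℤ s (alternateℤ s z) ≡⟨ cong (alternateℤ s) (alternateℤ-odd s o) ⟩
    alternateℤ s (z - s)          ≡⟨ alternateℤ-even s (odd+odd o (neg-odd s-odd)) ⟩
    z - s + s                     ≡⟨ cancel z s ⟩
    z                             ∎
    where
    open ≡-Reasoning
    cancel : ∀ z s → z - s + s ≡ z
    cancel = solve-∀

  alternateℤ-cong : ∀ {m s x y} → + 2 ∣ + m → x ≡ y mod m → alternateℤ s x ≡ alternateℤ s y mod m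
  alternateℤ-cong {s = s} 2∣m x≡y =
    +-cong-mod x≡y (mod-reflexive (cong (λ r → signed r s) (mod⇒%ℕ≡ (mod-weaken 2∣m x≡y))))

  module Prism (n : ℕ) .{{_ : NonZero n}} where

    index : ℤ → Fin n
    index z = fromℕ< (n%ℕd<d z n)

    uℤ vℤ : ℤ → V n
    uℤ z = u (index z)
    vℤ z = v (index z)

    index-mod : ∀ z → + toℕ (index z) ≡ z mod n
    index-mod z = subst (λ r → + r ≡ z mod n) (sym (FinP.toℕ-fromℕ< _)) (%ℕ-mod z)

    index-cong : ∀ {x y} → x ≡ y mod n → index x ≡ index y
    index-cong {x} {y} x≡y = FinP.toℕ-injective
      (trans (FinP.toℕ-fromℕ< _) (trans (mod⇒%ℕ≡ x≡y) (sym (FinP.toℕ-fromℕ< _))))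

    index-injective : ∀ {x y} → index x ≡ index y → x ≡ y mod n
    index-injective {x} {y} eq =
      mod-trans (mod-sym (index-mod x)) (subst (λ i → + toℕ i ≡ y mod n) (sym eq) (index-mod y))

    index-toℕ : ∀ (i : Fin n) → index (+ toℕ i) ≡ i
    index-toℕ i = FinP.toℕ-injective (trans (FinP.toℕ-fromℕ< _) (ℕD.m<n⇒m%n≡m (FinP.toℕ<n i)))

    uℤ-cong : ∀ {x y} → x ≡ y mod n → uℤ x ≡ uℤ y
    uℤ-cong x≡y = cong u (index-cong x≡y)

    vℤ-cong : ∀ {x y} → x ≡ y mod n → vℤ x ≡ vℤ y
    vℤ-cong x≡y = cong v (index-cong x≡y)

    uℤ-injective : ∀ {x y} → uℤ x ≡ uℤ y → x ≡ y mod n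
    uℤ-injective eq = index-injective (u-injective eq)
      where
      u-injective : ∀ {i j : Fin n} → u i ≡ u j → i ≡ j
      u-injective refl = refl

    vℤ-injective : ∀ {x y} → vℤ x ≡ vℤ y → x ≡ y mod n
    vℤ-injective eq = index-injective (v-injective eq)
      where
      v-injective : ∀ {i j : Fin n} → v i ≡ v j → i ≡ j
      v-injective refl = refl

    u≡uℤ : ∀ i → u i ≡ uℤ (+ toℕ i)
    u≡uℤ i = cong u (sym (index-toℕ i))

    v≡vℤ : ∀ i → v i ≡ vℤ (+ toℕ i)
    v≡vℤ i = cong v (sym (index-toℕ i))

    spoke : V n → V n
    spoke (u i) = v i
    spoke (v i) = u i

    spoke-involutive : ∀ x → spoke (spoke x) ≡ x
    spoke-involutive (u i) = refl
    spoke-involutive (v i) = refl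

    alternate : ℤ → ℤ → V n → V n
    alternate s t (u i) = uℤ (alternateℤ s (+ toℕ i))
    alternate s t (v i) = vℤ (alternateℤ t (+ toℕ i))

    module Parity (2∣n : + 2 ∣ + n) where

      index-parity : ∀ z → toℕ (index z) ℕ.% 2 ≡ z %ℕ 2
      index-parity z = mod⇒%ℕ≡ (mod-weaken 2∣n (index-mod z))

      alternate-uℤ : ∀ s t z → alternate s t (uℤ z) ≡ uℤ (alternateℤ s z)
      alternate-uℤ s t z = uℤ-cong (alternateℤ-cong 2∣n (index-mod z))

      alternate-vℤ : ∀ s t z → alternate s t (vℤ z) ≡ vℤ (alternateℤ t z)
      alternate-vℤ s t z = vℤ-cong (alternateℤ-cong 2∣n (index-mod z))

      alternate-involutive : ∀ {s t} → Odd s → Odd t → ∀ x → alternate s t (alternate s t x) ≡ x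
      alternate-involutive {s} {t} s-odd t-odd (u i) = trans (alternate-uℤ s t (alternateℤ s (+ toℕ i)))
        (trans (cong uℤ (alternateℤ-involutive s-odd (+ toℕ i))) (sym (u≡uℤ i)))
      alternate-involutive {s} {t} s-odd t-odd (v i) = trans (alternate-vℤ s t (alternateℤ t (+ toℕ i)))
        (trans (cong vℤ (alternateℤ-involutive t-odd (+ toℕ i))) (sym (v≡vℤ i)))

      module _ (s t : ℤ) {z : ℤ} where

        alternate-uᵉ : Even z → alternate s t (uℤ z) ≡ uℤ (z + s)
        alternate-uᵉ e = trans (alternate-uℤ s t z) (cong uℤ (alternateℤ-even s e))

        alternate-uᵒ : Odd z → alternate s t (uℤ z) ≡ uℤ (z - s)
        alternate-uᵒ o = trans (alternate-uℤ s t z) (cong uℤ (alternateℤ-odd s o))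

        alternate-vᵉ : Even z → alternate s t (vℤ z) ≡ vℤ (z + t)
        alternate-vᵉ e = trans (alternate-vℤ s t z) (cong vℤ (alternateℤ-even t e))

        alternate-vᵒ : Odd z → alternate s t (vℤ z) ≡ vℤ (z - t)
        alternate-vᵒ o = trans (alternate-vℤ s t z) (cong vℤ (alternateℤ-odd t o))

    module Colouring (B A : ℤ) where

      -- On the rim, blue joins u_i to u_{i+1} for even i and green does so for odd i.
      blue green : V n → V n
      blue = alternate 1ℤ B
      green = alternate -1ℤ A

      record Rotating (f : V n → V n) : Set where
        field
          spoke⇒green : ∀ x → f (spoke x) ≡ green (f x)
          blue⇒spoke  : ∀ x → f (blue x) ≡ spoke (f x)
          green⇒blue  : ∀ x → f (green x) ≡ blue (f x)
          fixes-u₀    : f (uℤ 0ℤ) ≡ uℤ 0ℤ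

      module Properties (2∣n : + 2 ∣ + n) where

        open Parity 2∣n

        blue-involutive : Odd B → ∀ x → blue (blue x) ≡ x
        blue-involutive = alternate-involutive mod-refl

        green-involutive : Odd A → ∀ x → green (green x) ≡ x
        green-involutive = alternate-involutive (neg-odd mod-refl)

        rim-successor : ∀ k → blue (uℤ (+ k)) ≡ uℤ (+ suc k) ⊎ green (uℤ (+ k)) ≡ uℤ (+ suc k)
        rim-successor k with even-or-odd (+ k)
        ... | inj₁ e = inj₁ (trans (alternate-uᵉ 1ℤ B e) (cong (λ r → uℤ (+ r)) (ℕP.+-comm k 1)))
        ... | inj₂ o = inj₂ (trans (alternate-uᵒ -1ℤ A o) (cong (λ r → uℤ (+ r)) (ℕP.+-comm k 1)))

        commutes∧fixes-u₀⇒id : ∀ (h : V n → V n) →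
          (∀ x → h (spoke x) ≡ spoke (h x)) → (∀ x → h (blue x) ≡ blue (h x)) →
          (∀ x → h (green x) ≡ green (h x)) → h (uℤ 0ℤ) ≡ uℤ 0ℤ → ∀ x → h x ≡ x
        commutes∧fixes-u₀⇒id h h-spoke h-blue h-green h-u₀ = fixed
          where
          fixes-rim : ∀ k → h (uℤ (+ k)) ≡ uℤ (+ k)
          fixes-rim zero = h-u₀
          fixes-rim (suc k) with rim-successor k
          ... | inj₁ step = trans (cong h (sym step)) (trans (h-blue _) (trans (cong blue (fixes-rim k)) step))
          ... | inj₂ step = trans (cong h (sym step)) (trans (h-green _) (trans (cong green (fixes-rim k)) step))

          fixed-u : ∀ i → h (u i) ≡ u i
          fixed-u i = trans (cong h (u≡uℤ i)) (trans (fixes-rim (toℕ i)) (sym (u≡uℤ i)))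

          fixed : ∀ x → h x ≡ x
          fixed (u i) = fixed-u i
          fixed (v i) = trans (h-spoke (u i)) (cong spoke (fixed-u i))

        rotating-cube≡id : ∀ {f} → Rotating f → ∀ x → f (f (f x)) ≡ x
        rotating-cube≡id {f} rot = commutes∧fixes-u₀⇒id (λ x → f (f (f x)))
          (λ x → trans (cong (λ y → f (f y)) (spoke⇒green x)) (trans (cong f (green⇒blue _)) (blue⇒spoke _)))
          (λ x → trans (cong (λ y → f (f y)) (blue⇒spoke x)) (trans (cong f (spoke⇒green _)) (green⇒blue _)))
          (λ x → trans (cong (λ y → f (f y)) (green⇒blue x)) (trans (cong f (blue⇒spoke _)) (spoke⇒green _)))
          (trans (cong (λ y → f (f y)) fixes-u₀) (trans (cong f fixes-u₀) fixes-u₀))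
          where open Rotating rot

  involution-swap : ∀ {A : Set} {f : A → A} → (∀ x → f (f x) ≡ x) → ∀ {x y} → y ≡ f x → x ≡ f y
  involution-swap {f = f} inv {x} y≡fx = trans (sym (inv x)) (cong f (sym y≡fx))

  Sym-graph : ∀ {n} {P : V n → V n → Set} {f : V n → V n} → (∀ x → f (f x) ≡ x) →
              (∀ {x y} → P x y → y ≡ f x) → ∀ {x y} → Sym P x y → y ≡ f x
  Sym-graph inv P⇒graph (inj₁ p) = P⇒graph p
  Sym-graph inv P⇒graph (inj₂ p) = involution-swap inv (P⇒graph p)

  Sym-map : ∀ {n} {P Q : V n → V n → Set} → (∀ {x y} → P x y → Q x y) → ∀ {x y} → Sym P x y → Sym Q x y
  Sym-map P⇒Q (inj₁ p) = inj₁ (P⇒Q p)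
  Sym-map P⇒Q (inj₂ p) = inj₂ (P⇒Q p)

  graph-transport : ∀ {A : Set} {f p q : A → A} → (∀ {x y} → f x ≡ f y → x ≡ y) →
                    (∀ x → f (p x) ≡ q (f x)) → ∀ x y → (y ≡ p x) ⇔ (f y ≡ q (f x))
  graph-transport {f = f} f-injective f∘p≡q∘f x y =
    mk⇔ (λ y≡px → trans (cong f y≡px) (f∘p≡q∘f x)) (λ fy≡qfx → f-injective (trans fy≡qfx (sym (f∘p≡q∘f x))))

  MapsOnto-inverse : ∀ {n} (φ : V n ↔ V n) {P Q : V n → V n → Set} →
                     MapsOnto (Inverse.to φ) P Q → MapsOnto (Inverse.from φ) Q P
  MapsOnto-inverse φ {P} {Q} φ-P→Q x y = mk⇔
    (λ q → Equivalence.from (φ-P→Q (from x) (from y)) (subst₂ Q (sym (to∘from x)) (sym (to∘from y)) q))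
    (λ p → subst₂ Q (to∘from x) (to∘from y) (Equivalence.to (φ-P→Q (from x) (from y)) p))
    where
    open Inverse φ using (to; from)
    to∘from : ∀ y → to (from y) ≡ y
    to∘from = Inverse.strictlyInverseˡ φ

  module _ {n : ℕ} {P Q : V n → V n → Set} {p q : V n → V n}
           (P⇔graph : ∀ x y → P x y ⇔ (y ≡ p x)) (Q⇔graph : ∀ x y → Q x y ⇔ (y ≡ q x)) where

    commutes⇒MapsOnto : ∀ {f} → (∀ {x y} → f x ≡ f y → x ≡ y) → (∀ x → f (p x) ≡ q (f x)) → MapsOnto f P Q
    commutes⇒MapsOnto {f} f-injective f∘p≡q∘f x y = ⇔.trans (P⇔graph x y)
      (⇔.trans (graph-transport {f = f} {p} {q} f-injective f∘p≡q∘f x y) (⇔.sym (Q⇔graph (f x) (f y))))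

    MapsOnto⇒commutes : ∀ {f} → MapsOnto f P Q → ∀ x → f (p x) ≡ q (f x)
    MapsOnto⇒commutes {f} f-P→Q x = Equivalence.to (Q⇔graph (f x) (f (p x)))
      (Equivalence.to (f-P→Q x (p x)) (Equivalence.from (P⇔graph x (p x)) refl))

  module ColourClasses (n a b : ℕ) .{{_ : NonZero n}} (2∣n : + 2 ∣ + n)
                       (a-odd : Odd (+ a)) (b-odd : Odd (+ b)) (¬condA : ¬ CondA n a b) where

    open Prism n
    open Parity 2∣n
    open Colouring (+ b) (+ a)
    open Properties 2∣n

    Arc : (ℕ → V n) → ℕ → ℕ → V n → V n → Set
    Arc C p s x y = Σ ℕ λ i → i ℕ.< n × i ℕ.% 2 ≡ p × x ≡ C i × y ≡ C (i ℕ.+ s)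

    arc-at : ∀ (c : Fin n → V n) p s z → z %ℕ 2 ≡ p →
             Arc (λ k → c (index (+ k))) p s (c (index z)) (c (index (z + + s)))
    arc-at c p s z z%2 = toℕ (index z) , FinP.toℕ<n _ , trans (index-parity z) z%2 ,
      cong c (sym (index-toℕ _)) , cong c (index-cong (+-cong-mod (mod-sym (index-mod z)) mod-refl))

    BlueArc GreenArc Edge : V n → V n → Set
    BlueArc x y = RimArc n 0 x y ⊎ ((CondA n a b × ChordArc n a x y) ⊎ (¬ CondA n a b × ChordArc n b x y))
    GreenArc x y = RimArc n 1 x y ⊎ ((CondA n a b × ChordArc n b x y) ⊎ (¬ CondA n a b × ChordArc n a x y))
    Edge x y = RimArcAll n x y ⊎ SpokeArc n x y ⊎ ChordArc n a x y ⊎ ChordArc n b x y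

    z-s+s : ∀ z s → z - s + s ≡ z
    z-s+s = solve-∀

    spoke-edge : ∀ x → Rset n x (spoke x)
    spoke-edge (u i) = inj₁ (toℕ i , FinP.toℕ<n i , u≡uℤ i , v≡vℤ i)
    spoke-edge (v i) = inj₂ (toℕ i , FinP.toℕ<n i , u≡uℤ i , v≡vℤ i)

    blue-edge : ∀ x → Bset n a b x (blue x)
    blue-edge (u i) = subst (λ x → Bset n a b x (blue x)) (sym (u≡uℤ i)) (at (+ toℕ i))
      where
      at : ∀ z → Bset n a b (uℤ z) (blue (uℤ z))
      at z with even-or-odd z
      ... | inj₁ e = subst (Bset n a b (uℤ z)) (sym (alternate-uᵉ 1ℤ (+ b) e))
                       (inj₁ (inj₁ (arc-at u 0 1 z (mod⇒%ℕ≡ e))))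
      ... | inj₂ o = subst₂ (Bset n a b) (cong uℤ (z-s+s z 1ℤ)) (sym (alternate-uᵒ 1ℤ (+ b) o))
                       (inj₂ (inj₁ (arc-at u 0 1 (z - 1ℤ) (mod⇒%ℕ≡ (odd+odd o (neg-odd mod-refl))))))
    blue-edge (v i) = subst (λ x → Bset n a b x (blue x)) (sym (v≡vℤ i)) (at (+ toℕ i))
      where
      at : ∀ z → Bset n a b (vℤ z) (blue (vℤ z))
      at z with even-or-odd z
      ... | inj₁ e = subst (Bset n a b (vℤ z)) (sym (alternate-vᵉ 1ℤ (+ b) e))
                       (inj₁ (inj₂ (inj₂ (¬condA , arc-at v 0 b z (mod⇒%ℕ≡ e)))))
      ... | inj₂ o = subst₂ (Bset n a b) (cong vℤ (z-s+s z (+ b))) (sym (alternate-vᵒ 1ℤ (+ b) o))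
                       (inj₂ (inj₂ (inj₂ (¬condA , arc-at v 0 b (z - + b) (mod⇒%ℕ≡ (odd+odd o (neg-odd b-odd)))))))

    green-edge : ∀ x → Gset n a b x (green x)
    green-edge (u i) = subst (λ x → Gset n a b x (green x)) (sym (u≡uℤ i)) (at (+ toℕ i))
      where
      at : ∀ z → Gset n a b (uℤ z) (green (uℤ z))
      at z with even-or-odd z
      ... | inj₂ o = subst (Gset n a b (uℤ z)) (sym (alternate-uᵒ -1ℤ (+ a) o))
                       (inj₁ (inj₁ (arc-at u 1 1 z (mod⇒%ℕ≡ o))))
      ... | inj₁ e = subst₂ (Gset n a b) (cong uℤ (z-s+s z 1ℤ)) (sym (alternate-uᵉ -1ℤ (+ a) e))
                       (inj₂ (inj₁ (arc-at u 1 1 (z - 1ℤ) (mod⇒%ℕ≡ (even+odd e (neg-odd mod-refl))))))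
    green-edge (v i) = subst (λ x → Gset n a b x (green x)) (sym (v≡vℤ i)) (at (+ toℕ i))
      where
      at : ∀ z → Gset n a b (vℤ z) (green (vℤ z))
      at z with even-or-odd z
      ... | inj₁ e = subst (Gset n a b (vℤ z)) (sym (alternate-vᵉ -1ℤ (+ a) e))
                       (inj₁ (inj₂ (inj₂ (¬condA , arc-at v 0 a z (mod⇒%ℕ≡ e)))))
      ... | inj₂ o = subst₂ (Gset n a b) (cong vℤ (z-s+s z (+ a))) (sym (alternate-vᵒ -1ℤ (+ a) o))
                       (inj₂ (inj₂ (inj₂ (¬condA , arc-at v 0 a (z - + a) (mod⇒%ℕ≡ (odd+odd o (neg-odd a-odd)))))))

    Rset⇒spoke : ∀ {x y} → Rset n x y → y ≡ spoke x
    Rset⇒spoke = Sym-graph spoke-involutive arc⇒spoke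
      where
      arc⇒spoke : ∀ {x y} → SpokeArc n x y → y ≡ spoke x
      arc⇒spoke (i , _ , refl , refl) = refl

    Bset⇒blue : ∀ {x y} → Bset n a b x y → y ≡ blue x
    Bset⇒blue = Sym-graph (blue-involutive b-odd) arc⇒blue
      where
      arc⇒blue : ∀ {x y} → BlueArc x y → y ≡ blue x
      arc⇒blue (inj₁ (i , _ , i-even , refl , refl)) = sym (alternate-uᵉ 1ℤ (+ b) {+ i} (%ℕ≡⇒mod i-even))
      arc⇒blue (inj₂ (inj₁ (condA , _))) = ⊥-elim (¬condA condA)
      arc⇒blue (inj₂ (inj₂ (_ , j , _ , j-even , refl , refl))) = sym (alternate-vᵉ 1ℤ (+ b) {+ j} (%ℕ≡⇒mod j-even))

    Gset⇒green : ∀ {x y} → Gset n a b x y → y ≡ green x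
    Gset⇒green = Sym-graph (green-involutive a-odd) arc⇒green
      where
      arc⇒green : ∀ {x y} → GreenArc x y → y ≡ green x
      arc⇒green (inj₁ (i , _ , i-odd , refl , refl)) = sym (alternate-uᵒ -1ℤ (+ a) {+ i} (%ℕ≡⇒mod i-odd))
      arc⇒green (inj₂ (inj₁ (condA , _))) = ⊥-elim (¬condA condA)
      arc⇒green (inj₂ (inj₂ (_ , j , _ , j-even , refl , refl))) = sym (alternate-vᵉ -1ℤ (+ a) {+ j} (%ℕ≡⇒mod j-even))

    Rset⇔spoke : ∀ x y → Rset n x y ⇔ (y ≡ spoke x)
    Rset⇔spoke x y = mk⇔ Rset⇒spoke (λ { refl → spoke-edge x })

    Bset⇔blue : ∀ x y → Bset n a b x y ⇔ (y ≡ blue x)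
    Bset⇔blue x y = mk⇔ Bset⇒blue (λ { refl → blue-edge x })

    Gset⇔green : ∀ x y → Gset n a b x y ⇔ (y ≡ green x)
    Gset⇔green x y = mk⇔ Gset⇒green (λ { refl → green-edge x })

    Matched : V n → V n → Set
    Matched x y = y ≡ spoke x ⊎ y ≡ blue x ⊎ y ≡ green x

    Adj⇔Matched : ∀ x y → Adj n a b x y ⇔ Matched x y
    Adj⇔Matched x y = mk⇔ adj⇒matched matched⇒adj
      where
      edge⇒matched : ∀ {x y} → Edge x y → Matched x y
      edge⇒matched (inj₁ (i , i<n , x≡ , y≡)) with i ℕ.% 2 in i%2 | ℕD.m%n<n i 2
      ... | 0 | _ = inj₂ (inj₁ (Bset⇒blue (inj₁ (inj₁ (i , i<n , i%2 , x≡ , y≡)))))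
      ... | 1 | _ = inj₂ (inj₂ (Gset⇒green (inj₁ (inj₁ (i , i<n , i%2 , x≡ , y≡)))))
      ... | suc (suc _) | ℕ.s≤s (ℕ.s≤s ())
      edge⇒matched (inj₂ (inj₁ s)) = inj₁ (Rset⇒spoke (inj₁ s))
      edge⇒matched (inj₂ (inj₂ (inj₁ c))) = inj₂ (inj₂ (Gset⇒green (inj₁ (inj₂ (inj₂ (¬condA , c))))))
      edge⇒matched (inj₂ (inj₂ (inj₂ c))) = inj₂ (inj₁ (Bset⇒blue (inj₁ (inj₂ (inj₂ (¬condA , c))))))

      matched-sym : ∀ {x y} → Matched y x → Matched x y
      matched-sym (inj₁ e) = inj₁ (involution-swap {f = spoke} spoke-involutive e)
      matched-sym (inj₂ (inj₁ e)) = inj₂ (inj₁ (involution-swap {f = blue} (blue-involutive b-odd) e))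
      matched-sym (inj₂ (inj₂ e)) = inj₂ (inj₂ (involution-swap {f = green} (green-involutive a-odd) e))

      adj⇒matched : Adj n a b x y → Matched x y
      adj⇒matched (inj₁ e) = edge⇒matched e
      adj⇒matched (inj₂ e) = matched-sym (edge⇒matched e)

      spoke⇒edge : ∀ {x y} → SpokeArc n x y → Edge x y
      spoke⇒edge s = inj₂ (inj₁ s)

      blue⇒edge : ∀ {x y} → BlueArc x y → Edge x y
      blue⇒edge (inj₁ (i , i<n , _ , x≡ , y≡)) = inj₁ (i , i<n , x≡ , y≡)
      blue⇒edge (inj₂ (inj₁ (_ , c))) = inj₂ (inj₂ (inj₁ c))
      blue⇒edge (inj₂ (inj₂ (_ , c))) = inj₂ (inj₂ (inj₂ c))

      green⇒edge : ∀ {x y} → GreenArc x y → Edge x y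
      green⇒edge (inj₁ (i , i<n , _ , x≡ , y≡)) = inj₁ (i , i<n , x≡ , y≡)
      green⇒edge (inj₂ (inj₁ (_ , c))) = inj₂ (inj₂ (inj₂ c))
      green⇒edge (inj₂ (inj₂ (_ , c))) = inj₂ (inj₂ (inj₁ c))

      matched⇒adj : Matched x y → Adj n a b x y
      matched⇒adj (inj₁ refl) = Sym-map {P = SpokeArc n} spoke⇒edge (spoke-edge x)
      matched⇒adj (inj₂ (inj₁ refl)) = Sym-map {P = BlueArc} blue⇒edge (blue-edge x)
      matched⇒adj (inj₂ (inj₂ refl)) = Sym-map {P = GreenArc} green⇒edge (green-edge x)

    Matched-transport : ∀ {f} → Rotating f → (∀ {x y} → f x ≡ f y → x ≡ y) →
                        ∀ x y → Matched x y ⇔ Matched (f x) (f y)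
    Matched-transport {f} rot f-injective x y = mk⇔ forward backward
      where
      open Rotating rot
      forward : Matched x y → Matched (f x) (f y)
      forward (inj₁ e) = inj₂ (inj₂ (trans (cong f e) (spoke⇒green x)))
      forward (inj₂ (inj₁ e)) = inj₁ (trans (cong f e) (blue⇒spoke x))
      forward (inj₂ (inj₂ e)) = inj₂ (inj₁ (trans (cong f e) (green⇒blue x)))
      backward : Matched (f x) (f y) → Matched x y
      backward (inj₁ e) = inj₂ (inj₁ (f-injective (trans e (sym (blue⇒spoke x)))))
      backward (inj₂ (inj₁ e)) = inj₂ (inj₂ (f-injective (trans e (sym (green⇒blue x)))))
      backward (inj₂ (inj₂ e)) = inj₁ (f-injective (trans e (sym (spoke⇒green x))))

    rotating⇒cyclic : Σ (V n → V n) Rotating → Σ (V n ↔ V n) (CyclicAut n a b)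
    rotating⇒cyclic (f , rot) = φ , automorphism , fixes-u₀ , inj₂ (R→G , G→B , B→R)
      where
      open Rotating rot
      cube : ∀ x → f (f (f x)) ≡ x
      cube = rotating-cube≡id rot
      f-injective : ∀ {x y} → f x ≡ f y → x ≡ y
      f-injective {x} {y} e = trans (sym (cube x)) (trans (cong (λ z → f (f z)) e) (cube y))
      φ : V n ↔ V n
      φ = mk↔ₛ′ f (λ x → f (f x)) cube cube
      automorphism : IsAut n a b φ
      automorphism x y = ⇔.trans (Adj⇔Matched x y)
        (⇔.trans (Matched-transport rot f-injective x y) (⇔.sym (Adj⇔Matched (f x) (f y))))
      R→G : MapsOnto f (Rset n) (Gset n a b)
      R→G = commutes⇒MapsOnto Rset⇔spoke Gset⇔green f-injective spoke⇒green
      G→B : MapsOnto f (Gset n a b) (Bset n a b)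
      G→B = commutes⇒MapsOnto Gset⇔green Bset⇔blue f-injective green⇒blue
      B→R : MapsOnto f (Bset n a b) (Rset n)
      B→R = commutes⇒MapsOnto Bset⇔blue Rset⇔spoke f-injective blue⇒spoke

    cyclic⇒rotating : Σ (V n ↔ V n) (CyclicAut n a b) → Σ (V n → V n) Rotating
    cyclic⇒rotating (φ , _ , fixes-u₀ , inj₂ (R→G , G→B , B→R)) = Inverse.to φ , record
      { spoke⇒green = MapsOnto⇒commutes Rset⇔spoke Gset⇔green R→G
      ; blue⇒spoke = MapsOnto⇒commutes Bset⇔blue Rset⇔spoke B→R
      ; green⇒blue = MapsOnto⇒commutes Gset⇔green Bset⇔blue G→B
      ; fixes-u₀ = fixes-u₀
      }
    -- An automorphism cycling R → B → G → R has an inverse cycling R → G → B → R.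
    cyclic⇒rotating (φ , _ , fixes-u₀ , inj₁ (R→B , B→G , G→R)) = Inverse.from φ , record
      { spoke⇒green = MapsOnto⇒commutes Rset⇔spoke Gset⇔green (MapsOnto-inverse φ G→R)
      ; blue⇒spoke = MapsOnto⇒commutes Bset⇔blue Rset⇔spoke (MapsOnto-inverse φ R→B)
      ; green⇒blue = MapsOnto⇒commutes Gset⇔green Bset⇔blue (MapsOnto-inverse φ B→G)
      ; fixes-u₀ = trans (cong (Inverse.from φ) (sym fixes-u₀)) (Inverse.strictlyInverseʳ φ _)
      }

  module _ {n a b : ℕ} .{{_ : NonZero n}} where

    open Prism n using (vℤ-injective)

    v₀v[a]-green⇒¬CondA : a ℕ.< b → b ℕ.< n → a ℕ.% 2 ≡ 1 → Gset n a b (W n 0) (W n a) → ¬ CondA n a b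
    v₀v[a]-green⇒¬CondA a<b b<n a-odd (inj₁ (inj₁ (_ , _ , _ , () , _)))
    v₀v[a]-green⇒¬CondA a<b b<n a-odd (inj₁ (inj₂ (inj₁ (_ , j , j<n , _ , v₀≡vⱼ , vₐ≡vⱼ₊ᵦ)))) _ =
      ℕP.<-irrefl (residue-unique (ℕP.<-trans a<b b<n) b<n
        (mod-trans (vℤ-injective vₐ≡vⱼ₊ᵦ)
          (+-cong-mod {x = + j} {+ 0} {+ b} (mod-sym (vℤ-injective v₀≡vⱼ)) mod-refl))) a<b
    v₀v[a]-green⇒¬CondA a<b b<n a-odd (inj₁ (inj₂ (inj₂ (¬condA , _)))) = ¬condA
    v₀v[a]-green⇒¬CondA a<b b<n a-odd (inj₂ (inj₁ (_ , _ , _ , () , _)))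
    v₀v[a]-green⇒¬CondA a<b b<n a-odd (inj₂ (inj₂ (inj₁ (_ , j , j<n , j-even , vₐ≡vⱼ , _)))) _ =
      ℕP.1+n≢0 (trans (sym a-odd)
        (trans (cong (ℕ._% 2) (residue-unique (ℕP.<-trans a<b b<n) j<n (vℤ-injective vₐ≡vⱼ))) j-even))
    v₀v[a]-green⇒¬CondA a<b b<n a-odd (inj₂ (inj₂ (inj₂ (¬condA , _)))) = ¬condA

module RotatingMaps where

  open import Data.Nat as ℕ using (ℕ; zero; suc; NonZero)
  import Data.Nat.Properties as ℕP
  import Data.Nat.DivMod as ℕD
  import Data.Nat.Tactic.RingSolver as ℕSolver
  open import Data.Integer using (ℤ; +_; 0ℤ; 1ℤ; -1ℤ; _+_; _*_; _-_)
  import Data.Integer.Properties as ℤP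
  open import Data.Integer.Divisibility.Signed using (_∣_; divides; ∣-refl; ∣-trans)
  open import Data.Integer.Tactic.RingSolver using (solve-∀)
  open import Data.Fin using (Fin; toℕ)
  open import Data.Product using (Σ; _,_)
  open import Data.Sum using (_⊎_; inj₁; inj₂)
  open import Data.Empty using (⊥-elim)
  open import Relation.Binary.PropositionalEquality
    using (_≡_; _≢_; refl; sym; trans; cong; subst; subst₂; module ≡-Reasoning)
  open Congruences
  open ColouredPrism

  four : ℤ → ℕ → ℤ
  four K r = + 4 * K + + r

  four-suc : ∀ K r → four K r + 1ℤ ≡ four K (suc r)
  four-suc K r = trans (ℤP.+-assoc (+ 4 * K) (+ r) 1ℤ) (cong (λ s → + 4 * K + + s) (ℕP.+-comm r 1))

  four≡r-mod-2 : ∀ K r → four K r ≡ + r mod 2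
  four≡r-mod-2 K r = mod-by-multiple (+ 2 * K) ∣-refl (identity K (+ r))
    where
    identity : ∀ K r → + 4 * K + r - r ≡ (+ 2 * K) * + 2
    identity = solve-∀

  four-pred : ∀ K r → four K (suc r) - 1ℤ ≡ four K r
  four-pred K r = trans (cong (_- 1ℤ) (sym (four-suc K r))) (cancel (four K r))
    where
    cancel : ∀ z → z + 1ℤ - 1ℤ ≡ z
    cancel = solve-∀

  four-even₀ : ∀ K → Even (four K 0)
  four-even₀ K = four≡r-mod-2 K 0

  four-odd₁ : ∀ K → Odd (four K 1)
  four-odd₁ K = four≡r-mod-2 K 1

  four-even₂ : ∀ K → Even (four K 2)
  four-even₂ K = mod-trans (four≡r-mod-2 K 2) mod-self

  four-odd₃ : ∀ K → Odd (four K 3)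
  four-odd₃ K = mod-trans (four≡r-mod-2 K 3) (+-cong-mod {x = + 2} {y = 1ℤ} mod-self mod-refl)

  four-pos : ∀ q r → four (+ q) r ≡ + (4 ℕ.* q ℕ.+ r)
  four-pos q r = cong (_+ + r) (sym (ℤP.pos-* 4 q))

  m≡4[m/4]+m%4 : ∀ m → m ≡ 4 ℕ.* (m ℕ./ 4) ℕ.+ m ℕ.% 4
  m≡4[m/4]+m%4 m = trans (ℕD.m≡m%n+[m/n]*n m 4)
    (trans (ℕP.+-comm (m ℕ.% 4) _) (cong (ℕ._+ m ℕ.% 4) (ℕP.*-comm (m ℕ./ 4) 4)))

  four-div-mod : ∀ m → four (+ (m ℕ./ 4)) (m ℕ.% 4) ≡ + m
  four-div-mod m = trans (four-pos (m ℕ./ 4) (m ℕ.% 4)) (cong +_ (sym (m≡4[m/4]+m%4 m)))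

  odd⇒%4≡1∨3 : ∀ m → Odd (+ m) → m ℕ.% 4 ≡ 1 ⊎ m ℕ.% 4 ≡ 3
  odd⇒%4≡1∨3 m m-odd
    with m ℕ.% 4 | ℕD.m%n<n m 4 | mod-trans (mod-sym (mod-reflexive (four-div-mod m))) (four≡r-mod-2 (+ (m ℕ./ 4)) (m ℕ.% 4))
  ... | 0 | _ | m≡0 = ⊥-elim (even⇒¬odd m≡0 m-odd)
  ... | 1 | _ | _ = inj₁ refl
  ... | 2 | _ | m≡2 = ⊥-elim (even⇒¬odd (mod-trans m≡2 mod-self) m-odd)
  ... | 3 | _ | _ = inj₂ refl
  ... | suc (suc (suc (suc _))) | ℕ.s≤s (ℕ.s≤s (ℕ.s≤s (ℕ.s≤s ()))) | _

  0<4 : 0 ℕ.< 4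
  0<4 = ℕ.s≤s ℕ.z≤n

  1<4 : 1 ℕ.< 4
  1<4 = ℕ.s≤s (ℕ.s≤s ℕ.z≤n)

  2<4 : 2 ℕ.< 4
  2<4 = ℕ.s≤s (ℕ.s≤s (ℕ.s≤s ℕ.z≤n))

  3<4 : 3 ℕ.< 4
  3<4 = ℕ.s≤s (ℕ.s≤s (ℕ.s≤s (ℕ.s≤s ℕ.z≤n)))

  module Walk (n : ℕ) .{{_ : NonZero n}} (2∣n : + 2 ∣ + n) {B A : ℤ} (B-odd : Odd B) (A-odd : Odd A) where

    open Prism n public
    open Parity 2∣n public
    open Colouring B A public
    open Properties 2∣n public

    c : ℤ
    c = B - 1ℤ

    walk : ℤ → ℕ → V n
    walk K 0 = uℤ (K * c)
    walk K 1 = vℤ (K * c)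
    walk K 2 = vℤ (K * c + B)
    walk K _ = uℤ (K * c + B)

    Kc-even : ∀ K → Even (K * c)
    Kc-even K = *-even K (odd+odd B-odd (neg-odd mod-refl))

    Kc+B-odd : ∀ K → Odd (K * c + B)
    Kc+B-odd K = even+odd (Kc-even K) B-odd

    blue-walk₁ : ∀ K → blue (walk K 1) ≡ walk K 2
    blue-walk₁ K = alternate-vᵉ 1ℤ B (Kc-even K)

    blue-walk₃ : ∀ K → blue (walk K 3) ≡ walk (K + 1ℤ) 0
    blue-walk₃ K = trans (alternate-uᵒ 1ℤ B (Kc+B-odd K)) (cong uℤ (next-block K B))
      where
      next-block : ∀ K B → K * (B - 1ℤ) + B - 1ℤ ≡ (K + 1ℤ) * (B - 1ℤ)
      next-block = solve-∀

    green-walk₀ : ∀ K → green (walk K 0) ≡ uℤ (K * c - 1ℤ)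
    green-walk₀ K = alternate-uᵉ -1ℤ A (Kc-even K)

    green-walk₁ : ∀ K → green (walk K 1) ≡ vℤ (K * c + A)
    green-walk₁ K = alternate-vᵉ -1ℤ A (Kc-even K)

    green-walk₂ : ∀ K → green (walk K 2) ≡ vℤ (K * c + B - A)
    green-walk₂ K = alternate-vᵒ -1ℤ A (Kc+B-odd K)

    green-walk₃ : ∀ K → green (walk K 3) ≡ uℤ (K * c + B + 1ℤ)
    green-walk₃ K = alternate-uᵒ -1ℤ A (Kc+B-odd K)

    module _ {f : V n → V n} (rot : Rotating f) where

      open Rotating rot
      open ≡-Reasoning

      f-rim-even : ∀ K r → Even (four K r) → f (uℤ (four K (suc r))) ≡ spoke (f (uℤ (four K r)))
      f-rim-even K r e = trans (cong (λ z → f (uℤ z)) (sym (four-suc K r)))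
        (trans (cong f (sym (alternate-uᵉ 1ℤ B e))) (blue⇒spoke _))

      f-rim-odd : ∀ K r → Odd (four K r) → f (uℤ (four K (suc r))) ≡ blue (f (uℤ (four K r)))
      f-rim-odd K r o = trans (cong (λ z → f (uℤ z)) (sym (four-suc K r)))
        (trans (cong f (sym (alternate-uᵒ -1ℤ A o))) (green⇒blue _))

      f-walk : ∀ k r → r ℕ.< 4 → f (uℤ (four (+ k) r)) ≡ walk (+ k) r
      f-walk zero 0 _ = trans fixes-u₀ (cong uℤ (sym (ℤP.*-zeroˡ c)))
      f-walk (suc k) 0 _ = begin
        f (uℤ (four (+ suc k) 0))       ≡⟨ cong (λ z → f (uℤ z)) (next-block k) ⟩
        f (uℤ (four (+ k) 4))           ≡⟨ f-rim-odd (+ k) 3 (four-odd₃ (+ k)) ⟩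
        blue (f (uℤ (four (+ k) 3)))    ≡⟨ cong blue (f-walk k 3 3<4) ⟩
        blue (walk (+ k) 3)             ≡⟨ blue-walk₃ (+ k) ⟩
        walk (+ k + 1ℤ) 0               ≡⟨ cong (λ K → walk (+ K) 0) (ℕP.+-comm k 1) ⟩
        walk (+ suc k) 0                ∎
        where
        next-block : ∀ k → four (+ suc k) 0 ≡ four (+ k) 4
        next-block k = trans (cong (λ K → four K 0) (cong +_ (ℕP.+-comm 1 k))) (identity (+ k))
          where
          identity : ∀ K → + 4 * (K + 1ℤ) + + 0 ≡ + 4 * K + + 4
          identity = solve-∀
      f-walk k 1 _ = trans (f-rim-even (+ k) 0 (four-even₀ (+ k))) (cong spoke (f-walk k 0 0<4))
      f-walk k 2 _ = trans (f-rim-odd (+ k) 1 (four-odd₁ (+ k))) (trans (cong blue (f-walk k 1 1<4)) (blue-walk₁ (+ k)))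
      f-walk k 3 _ = trans (f-rim-even (+ k) 2 (four-even₂ (+ k))) (cong spoke (f-walk k 2 2<4))
      f-walk k (suc (suc (suc (suc _)))) (ℕ.s≤s (ℕ.s≤s (ℕ.s≤s (ℕ.s≤s ()))))

      f-spoke-walk : ∀ k r → r ℕ.< 4 → f (vℤ (four (+ k) r)) ≡ green (walk (+ k) r)
      f-spoke-walk k r r<4 = trans (spoke⇒green (uℤ (four (+ k) r))) (cong green (f-walk k r r<4))

  record RotationCondition (n a b : ℕ) : Set where
    field
      β α         : ℕ
      b≡4β+1      : b ≡ 4 ℕ.* β ℕ.+ 1
      a+1≡4α      : a ℕ.+ 1 ≡ 4 ℕ.* α
      n∣4[β²+α]   : + n ∣ + 4 * (+ β * + β + + α)
      n∣4[αβ+1]   : + n ∣ + 4 * (+ α * + β + 1ℤ)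
      n∣8[β-α+1]  : + n ∣ + 8 * (+ β - + α + 1ℤ)

  module NecessaryCondition (n a b : ℕ) .{{_ : NonZero n}} (2∣n : + 2 ∣ + n) (a-odd : Odd (+ a)) (b-odd : Odd (+ b))
                 {f : V n → V n} where

    open Walk n 2∣n b-odd a-odd

    module _ (rot : Rotating f) where

      open Rotating rot
      open ≡-Reasoning

      f-spoke-at : ∀ m → f (vℤ (+ m)) ≡ green (walk (+ (m ℕ./ 4)) (m ℕ.% 4))
      f-spoke-at m = trans (cong (λ z → f (vℤ z)) (sym (four-div-mod m)))
        (f-spoke-walk rot (m ℕ./ 4) (m ℕ.% 4) (ℕD.m%n<n m 4))

      f-v₀ : f (vℤ 0ℤ) ≡ uℤ -1ℤ
      f-v₀ = trans (spoke⇒green (uℤ 0ℤ)) (trans (cong green fixes-u₀) (alternate-uᵉ -1ℤ (+ a) mod-refl))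

      f-vb : f (vℤ (+ b)) ≡ vℤ -1ℤ
      f-vb = trans (cong f (sym (alternate-vᵉ 1ℤ (+ b) mod-refl))) (trans (blue⇒spoke _) (cong spoke f-v₀))

      f-va : f (vℤ (+ a)) ≡ uℤ (-1ℤ - 1ℤ)
      f-va = trans (cong f (sym (alternate-vᵉ -1ℤ (+ a) mod-refl)))
        (trans (green⇒blue _) (trans (cong blue f-v₀) (alternate-uᵒ 1ℤ (+ b) (neg-odd mod-refl))))

      u≢v : ∀ {i j : Fin n} → u i ≢ v j
      u≢v ()

      β κ : ℕ
      β = b ℕ./ 4
      κ = a ℕ./ 4

      b%4≡1 : b ℕ.% 4 ≡ 1
      b%4≡1 with odd⇒%4≡1∨3 b b-odd
      ... | inj₁ r = r
      ... | inj₂ r = ⊥-elim (u≢v (trans (sym (green-walk₃ (+ β)))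
                       (trans (sym (subst (λ r → f (vℤ (+ b)) ≡ green (walk (+ β) r)) r (f-spoke-at b))) f-vb)))

      a%4≡3 : a ℕ.% 4 ≡ 3
      a%4≡3 with odd⇒%4≡1∨3 a a-odd
      ... | inj₂ r = r
      ... | inj₁ r = ⊥-elim (u≢v (sym (trans (sym (green-walk₁ (+ κ)))
                       (trans (sym (subst (λ r → f (vℤ (+ a)) ≡ green (walk (+ κ) r)) r (f-spoke-at a))) f-va))))

      b≡4β+1 : four (+ β) 1 ≡ + b
      b≡4β+1 = subst (λ r → four (+ β) r ≡ + b) b%4≡1 (four-div-mod b)

      a≡4κ+3 : four (+ κ) 3 ≡ + a
      a≡4κ+3 = subst (λ r → four (+ κ) r ≡ + a) a%4≡3 (four-div-mod a)

      spoke-b-congruence : + β * c + + a ≡ -1ℤ mod n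
      spoke-b-congruence = vℤ-injective (trans (sym (green-walk₁ (+ β)))
        (trans (sym (subst (λ r → f (vℤ (+ b)) ≡ green (walk (+ β) r)) b%4≡1 (f-spoke-at b))) f-vb))

      spoke-a-congruence : + κ * c + + b + 1ℤ ≡ -1ℤ - 1ℤ mod n
      spoke-a-congruence = uℤ-injective (trans (sym (green-walk₃ (+ κ)))
        (trans (sym (subst (λ r → f (vℤ (+ a)) ≡ green (walk (+ κ) r)) a%4≡3 (f-spoke-at a))) f-va))

      green-v₂-congruence : + (κ ℕ.+ 1) * c + + a ≡ 0ℤ * c + + b - + a + + b mod n
      green-v₂-congruence = vℤ-injective (begin
        vℤ (+ (κ ℕ.+ 1) * c + + a)        ≡⟨ green-walk₁ (+ (κ ℕ.+ 1)) ⟨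
        green (walk (+ (κ ℕ.+ 1)) 1)      ≡⟨ f-spoke-walk rot (κ ℕ.+ 1) 1 1<4 ⟨
        f (vℤ (four (+ (κ ℕ.+ 1)) 1))     ≡⟨ cong (λ z → f (vℤ z)) (two+a a≡4κ+3) ⟨
        f (vℤ (+ 2 + + a))                ≡⟨ cong f (alternate-vᵉ -1ℤ (+ a) (four-even₂ 0ℤ)) ⟨
        f (green (vℤ (+ 2)))              ≡⟨ green⇒blue (vℤ (+ 2)) ⟩
        blue (f (vℤ (+ 2)))               ≡⟨ cong blue (f-spoke-walk rot 0 2 2<4) ⟩
        blue (green (walk 0ℤ 2))          ≡⟨ cong blue (green-walk₂ 0ℤ) ⟩
        blue (vℤ (0ℤ * c + + b - + a))    ≡⟨ alternate-vᵉ 1ℤ (+ b) (odd+odd (Kc+B-odd 0ℤ) (neg-odd a-odd)) ⟩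
        vℤ (0ℤ * c + + b - + a + + b)     ∎)
        where
        two+a : ∀ {A} → four (+ κ) 3 ≡ A → + 2 + A ≡ four (+ (κ ℕ.+ 1)) 1
        two+a refl = identity (+ κ)
          where
          identity : ∀ K → + 2 + (+ 4 * K + + 3) ≡ + 4 * (K + 1ℤ) + + 1
          identity = solve-∀

      rotating⇒condition : RotationCondition n a b
      rotating⇒condition = record
        { β = β
        ; α = κ ℕ.+ 1
        ; b≡4β+1 = ℤP.+-injective (trans (sym b≡4β+1) (four-pos β 1))
        ; a+1≡4α = trans (cong (ℕ._+ 1) (ℤP.+-injective (trans (sym a≡4κ+3) (four-pos κ 3)))) (shift κ)
        ; n∣4[β²+α] = mod⇒∣ spoke-b-congruence (b-difference b≡4β+1 a≡4κ+3)
        ; n∣4[αβ+1] = mod⇒∣ spoke-a-congruence (a-difference b≡4β+1)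
        ; n∣8[β-α+1] = ∣-combination 1ℤ -1ℤ (mod⇒∣ spoke-a-congruence refl) (mod⇒∣ green-v₂-congruence refl)
                         (v₂-difference b≡4β+1 a≡4κ+3)
        }
        where
        shift : ∀ κ → 4 ℕ.* κ ℕ.+ 3 ℕ.+ 1 ≡ 4 ℕ.* (κ ℕ.+ 1)
        shift = ℕSolver.solve-∀
        -- b and a are abstracted to B and A so that matching refl substitutes 4β + 1 and 4κ + 3.
        b-difference : ∀ {B A} → four (+ β) 1 ≡ B → four (+ κ) 3 ≡ A →
          (+ β * (B - 1ℤ) + A) - -1ℤ ≡ + 4 * (+ β * + β + (+ κ + 1ℤ))
        b-difference refl refl = identity (+ β) (+ κ)
          where
          identity : ∀ β κ → (β * ((+ 4 * β + + 1) - 1ℤ) + (+ 4 * κ + + 3)) - -1ℤ ≡ + 4 * (β * β + (κ + 1ℤ))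
          identity = solve-∀
        a-difference : ∀ {B} → four (+ β) 1 ≡ B →
          (+ κ * (B - 1ℤ) + B + 1ℤ) - (-1ℤ - 1ℤ) ≡ + 4 * ((+ κ + 1ℤ) * + β + 1ℤ)
        a-difference refl = identity (+ β) (+ κ)
          where
          identity : ∀ β κ → (κ * ((+ 4 * β + + 1) - 1ℤ) + (+ 4 * β + + 1) + 1ℤ) - (-1ℤ - 1ℤ)
                             ≡ + 4 * ((κ + 1ℤ) * β + 1ℤ)
          identity = solve-∀
        v₂-difference : ∀ {B A} → four (+ β) 1 ≡ B → four (+ κ) 3 ≡ A →
          + 8 * (+ β - (+ κ + 1ℤ) + 1ℤ) ≡
          1ℤ * ((+ κ * (B - 1ℤ) + B + 1ℤ) - (-1ℤ - 1ℤ)) +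
          -1ℤ * ((+ κ + 1ℤ) * (B - 1ℤ) + A - (0ℤ * (B - 1ℤ) + B - A + B))
        v₂-difference refl refl = identity (+ β) (+ κ)
          where
          identity : ∀ β κ → + 8 * (β - (κ + 1ℤ) + 1ℤ) ≡
                     1ℤ * ((κ * ((+ 4 * β + + 1) - 1ℤ) + (+ 4 * β + + 1) + 1ℤ) - (-1ℤ - 1ℤ)) +
                     -1ℤ * ((κ + 1ℤ) * ((+ 4 * β + + 1) - 1ℤ) + (+ 4 * κ + + 3) -
                            (0ℤ * ((+ 4 * β + + 1) - 1ℤ) + (+ 4 * β + + 1) - (+ 4 * κ + + 3) + (+ 4 * β + + 1)))
          identity = solve-∀

  commute-via : ∀ {A B : Set} (f : A → B) (p : A → A) (q : B → B) (x : A) {x′ : A} {y y′ : B} →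
                f x ≡ y → f x′ ≡ y′ → p x ≡ x′ → y′ ≡ q y → f (p x) ≡ q (f x)
  commute-via f p q x fx≡y fx′≡y′ px≡x′ y′≡qy =
    trans (cong f px≡x′) (trans fx′≡y′ (trans y′≡qy (cong q (sym fx≡y))))

  module Construction (n : ℕ) .{{_ : NonZero n}} (4∣n : + 4 ∣ + n) (β α : ℤ)
                      (n∣4[β²+α] : + n ∣ + 4 * (β * β + α)) (n∣4[αβ+1] : + n ∣ + 4 * (α * β + 1ℤ))
                      (n∣8[β-α+1] : + n ∣ + 8 * (β - α + 1ℤ)) where

    B A : ℤ
    B = + 4 * β + 1ℤ
    A = + 4 * α - 1ℤ

    B-odd : Odd B
    B-odd = mod-by-multiple (+ 2 * β) ∣-refl (identity β)
      where
      identity : ∀ β → + 4 * β + 1ℤ - 1ℤ ≡ (+ 2 * β) * + 2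
      identity = solve-∀

    A-odd : Odd A
    A-odd = mod-by-multiple (+ 2 * α - 1ℤ) ∣-refl (identity α)
      where
      identity : ∀ α → + 4 * α - 1ℤ - 1ℤ ≡ (+ 2 * α - 1ℤ) * + 2
      identity = solve-∀

    2∣n : + 2 ∣ + n
    2∣n = ∣-trans (divides (+ 2) refl) 4∣n

    open Walk n 2∣n B-odd A-odd

    f : V n → V n
    f (u i) = walk (+ (toℕ i ℕ./ 4)) (toℕ i ℕ.% 4)
    f (v i) = green (f (u i))

    walk-cong : ∀ {K₁ K₂} r → four K₁ r ≡ four K₂ r mod n → walk K₁ r ≡ walk K₂ r
    walk-cong {K₁} {K₂} r 4K₁+r≡4K₂+r = at r
      where
      n∣4[K₁-K₂] : + n ∣ + 4 * (K₁ - K₂)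
      n∣4[K₁-K₂] = mod⇒∣ 4K₁+r≡4K₂+r (identity K₁ K₂ (+ r))
        where
        identity : ∀ K₁ K₂ r → (+ 4 * K₁ + r) - (+ 4 * K₂ + r) ≡ + 4 * (K₁ - K₂)
        identity = solve-∀
      K₁c≡K₂c : K₁ * c ≡ K₂ * c mod n
      K₁c≡K₂c = mod-by-multiple β n∣4[K₁-K₂] (identity K₁ K₂ β)
        where
        identity : ∀ K₁ K₂ β → K₁ * (+ 4 * β + 1ℤ - 1ℤ) - K₂ * (+ 4 * β + 1ℤ - 1ℤ) ≡ β * (+ 4 * (K₁ - K₂))
        identity = solve-∀
      at : ∀ r → walk K₁ r ≡ walk K₂ r
      at 0 = uℤ-cong K₁c≡K₂c
      at 1 = vℤ-cong K₁c≡K₂c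
      at 2 = vℤ-cong (+-cong-mod K₁c≡K₂c mod-refl)
      at (suc (suc (suc _))) = uℤ-cong (+-cong-mod K₁c≡K₂c mod-refl)

    f-uℤ : ∀ {z} K r → r ℕ.< 4 → z ≡ four K r mod n → f (uℤ z) ≡ walk K r
    f-uℤ {z} K r r<4 z≡4K+r = trans (cong (walk (+ (m ℕ./ 4))) m%4≡r)
      (walk-cong r (mod-trans m≡4[m/4]+r (mod-trans (index-mod z) z≡4K+r)))
      where
      m : ℕ
      m = toℕ (index z)
      m%4≡r : m ℕ.% 4 ≡ r
      m%4≡r = trans (mod⇒%ℕ≡ {4} (mod-weaken 4∣n (mod-trans (index-mod z) z≡4K+r)))
        (trans (mod⇒%ℕ≡ {4} {four K r} {+ r} (mod-by-multiple K ∣-refl (identity K (+ r)))) (ℕD.m<n⇒m%n≡m r<4))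
        where
        identity : ∀ K r → (+ 4 * K + r) - r ≡ K * + 4
        identity = solve-∀
      m≡4[m/4]+r : four (+ (m ℕ./ 4)) r ≡ + m mod n
      m≡4[m/4]+r = mod-reflexive (trans (cong (four (+ (m ℕ./ 4))) (sym m%4≡r)) (four-div-mod m))

    f-u : ∀ K r → r ℕ.< 4 → f (uℤ (four K r)) ≡ walk K r
    f-u K r r<4 = f-uℤ K r r<4 mod-refl

    f-v : ∀ K r → r ℕ.< 4 → f (vℤ (four K r)) ≡ green (walk K r)
    f-v K r r<4 = cong green (f-u K r r<4)

    at-congruent⇒≡ : ∀ {X Y : V n} (at : ℤ → V n) → (∀ {x y} → x ≡ y mod n → at x ≡ at y) → ∀ {x y} →
                X ≡ at x → Y ≡ at y → x ≡ y mod n → X ≡ Y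
    at-congruent⇒≡ at at-cong X≡ Y≡ x≡y = trans X≡ (trans (at-cong x≡y) (sym Y≡))

    blue-u : ∀ K r → r ℕ.< 4 → f (blue (uℤ (four K r))) ≡ spoke (f (uℤ (four K r)))
    blue-u K 0 _ = commute-via f blue spoke (uℤ (four K 0)) (f-u K 0 0<4) (f-u K 1 1<4)
      (trans (alternate-uᵉ 1ℤ B (four-even₀ K)) (cong uℤ (four-suc K 0))) refl
    blue-u K 1 _ = commute-via f blue spoke (uℤ (four K 1)) (f-u K 1 1<4) (f-u K 0 0<4)
      (trans (alternate-uᵒ 1ℤ B (four-odd₁ K)) (cong uℤ (four-pred K 0))) refl
    blue-u K 2 _ = commute-via f blue spoke (uℤ (four K 2)) (f-u K 2 2<4) (f-u K 3 3<4)
      (trans (alternate-uᵉ 1ℤ B (four-even₂ K)) (cong uℤ (four-suc K 2))) refl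
    blue-u K 3 _ = commute-via f blue spoke (uℤ (four K 3)) (f-u K 3 3<4) (f-u K 2 2<4)
      (trans (alternate-uᵒ 1ℤ B (four-odd₃ K)) (cong uℤ (four-pred K 2))) refl
    blue-u K (suc (suc (suc (suc _)))) (ℕ.s≤s (ℕ.s≤s (ℕ.s≤s (ℕ.s≤s ()))))

    green-u : ∀ K r → r ℕ.< 4 → f (green (uℤ (four K r))) ≡ blue (f (uℤ (four K r)))
    green-u K 0 _ = commute-via f green blue (uℤ (four K 0)) (f-u K 0 0<4) (f-u (K - 1ℤ) 3 3<4)
      (trans (alternate-uᵉ -1ℤ A (four-even₀ K)) (cong uℤ (previous-block K)))
      (involution-swap {f = blue} (blue-involutive B-odd)
        (sym (trans (blue-walk₃ (K - 1ℤ)) (cong (λ K → walk K 0) (cancel K)))))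
      where
      previous-block : ∀ K → + 4 * K + + 0 - 1ℤ ≡ + 4 * (K - 1ℤ) + + 3
      previous-block = solve-∀
      cancel : ∀ K → K - 1ℤ + 1ℤ ≡ K
      cancel = solve-∀
    green-u K 1 _ = commute-via f green blue (uℤ (four K 1)) (f-u K 1 1<4) (f-u K 2 2<4)
      (trans (alternate-uᵒ -1ℤ A (four-odd₁ K)) (cong uℤ (four-suc K 1))) (sym (blue-walk₁ K))
    green-u K 2 _ = commute-via f green blue (uℤ (four K 2)) (f-u K 2 2<4) (f-u K 1 1<4)
      (trans (alternate-uᵉ -1ℤ A (four-even₂ K)) (cong uℤ (four-pred K 1)))
      (involution-swap {f = blue} (blue-involutive B-odd) (sym (blue-walk₁ K)))
    green-u K 3 _ = commute-via f green blue (uℤ (four K 3)) (f-u K 3 3<4) (f-u (K + 1ℤ) 0 0<4)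
      (trans (alternate-uᵒ -1ℤ A (four-odd₃ K)) (cong uℤ (next-block K))) (sym (blue-walk₃ K))
      where
      next-block : ∀ K → + 4 * K + + 3 + 1ℤ ≡ + 4 * (K + 1ℤ) + + 0
      next-block = solve-∀
    green-u K (suc (suc (suc (suc _)))) (ℕ.s≤s (ℕ.s≤s (ℕ.s≤s (ℕ.s≤s ()))))

    blue-v : ∀ K r → r ℕ.< 4 → f (blue (vℤ (four K r))) ≡ spoke (f (vℤ (four K r)))
    blue-v K 0 _ = commute-via f blue spoke (vℤ (four K 0)) (f-v K 0 0<4) (f-v (K + β) 1 1<4)
      (trans (alternate-vᵉ 1ℤ B (four-even₀ K)) (cong vℤ (shifted K β)))
      (at-congruent⇒≡ vℤ vℤ-cong {(K + β) * c + A} {K * c - 1ℤ} (green-walk₁ (K + β)) (cong spoke (green-walk₀ K))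
        (mod-by-multiple 1ℤ n∣4[β²+α] (value K β α)))
      where
      shifted : ∀ K β → + 4 * K + + 0 + (+ 4 * β + 1ℤ) ≡ + 4 * (K + β) + + 1
      shifted = solve-∀
      value : ∀ K β α → ((K + β) * (+ 4 * β + 1ℤ - 1ℤ) + (+ 4 * α - 1ℤ)) - (K * (+ 4 * β + 1ℤ - 1ℤ) - 1ℤ)
                        ≡ 1ℤ * (+ 4 * (β * β + α))
      value = solve-∀
    blue-v K 1 _ = commute-via f blue spoke (vℤ (four K 1)) (f-v K 1 1<4) (f-v (K - β) 0 0<4)
      (trans (alternate-vᵒ 1ℤ B (four-odd₁ K)) (cong vℤ (shifted K β)))
      (at-congruent⇒≡ uℤ uℤ-cong {(K - β) * c - 1ℤ} {K * c + A} (green-walk₀ (K - β)) (cong spoke (green-walk₁ K))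
        (mod-by-multiple -1ℤ n∣4[β²+α] (value K β α)))
      where
      shifted : ∀ K β → + 4 * K + + 1 - (+ 4 * β + 1ℤ) ≡ + 4 * (K - β) + + 0
      shifted = solve-∀
      value : ∀ K β α → ((K - β) * (+ 4 * β + 1ℤ - 1ℤ) - 1ℤ) - (K * (+ 4 * β + 1ℤ - 1ℤ) + (+ 4 * α - 1ℤ))
                        ≡ -1ℤ * (+ 4 * (β * β + α))
      value = solve-∀
    blue-v K 2 _ = commute-via f blue spoke (vℤ (four K 2)) (f-v K 2 2<4) (f-v (K + β) 3 3<4)
      (trans (alternate-vᵉ 1ℤ B (four-even₂ K)) (cong vℤ (shifted K β)))
      (at-congruent⇒≡ uℤ uℤ-cong {(K + β) * c + B + 1ℤ} {K * c + B - A} (green-walk₃ (K + β)) (cong spoke (green-walk₂ K))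
        (mod-by-multiple 1ℤ n∣4[β²+α] (value K β α)))
      where
      shifted : ∀ K β → + 4 * K + + 2 + (+ 4 * β + 1ℤ) ≡ + 4 * (K + β) + + 3
      shifted = solve-∀
      value : ∀ K β α → ((K + β) * (+ 4 * β + 1ℤ - 1ℤ) + (+ 4 * β + 1ℤ) + 1ℤ)
                        - (K * (+ 4 * β + 1ℤ - 1ℤ) + (+ 4 * β + 1ℤ) - (+ 4 * α - 1ℤ))
                        ≡ 1ℤ * (+ 4 * (β * β + α))
      value = solve-∀
    blue-v K 3 _ = commute-via f blue spoke (vℤ (four K 3)) (f-v K 3 3<4) (f-v (K - β) 2 2<4)
      (trans (alternate-vᵒ 1ℤ B (four-odd₃ K)) (cong vℤ (shifted K β)))
      (at-congruent⇒≡ vℤ vℤ-cong {(K - β) * c + B - A} {K * c + B + 1ℤ} (green-walk₂ (K - β)) (cong spoke (green-walk₃ K))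
        (mod-by-multiple -1ℤ n∣4[β²+α] (value K β α)))
      where
      shifted : ∀ K β → + 4 * K + + 3 - (+ 4 * β + 1ℤ) ≡ + 4 * (K - β) + + 2
      shifted = solve-∀
      value : ∀ K β α → ((K - β) * (+ 4 * β + 1ℤ - 1ℤ) + (+ 4 * β + 1ℤ) - (+ 4 * α - 1ℤ))
                        - (K * (+ 4 * β + 1ℤ - 1ℤ) + (+ 4 * β + 1ℤ) + 1ℤ)
                        ≡ -1ℤ * (+ 4 * (β * β + α))
      value = solve-∀
    blue-v K (suc (suc (suc (suc _)))) (ℕ.s≤s (ℕ.s≤s (ℕ.s≤s (ℕ.s≤s ()))))

    green-v : ∀ K r → r ℕ.< 4 → f (green (vℤ (four K r))) ≡ blue (f (vℤ (four K r)))
    green-v K 0 _ = commute-via f green blue (vℤ (four K 0)) (f-v K 0 0<4) (f-v (K + α - 1ℤ) 3 3<4)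
      (trans (alternate-vᵉ -1ℤ A (four-even₀ K)) (cong vℤ (shifted K α)))
      (at-congruent⇒≡ uℤ uℤ-cong {(K + α - 1ℤ) * c + B + 1ℤ} {K * c - 1ℤ - 1ℤ} (green-walk₃ (K + α - 1ℤ))
        (trans (cong blue (green-walk₀ K)) (alternate-uᵒ 1ℤ B (even+odd (Kc-even K) (neg-odd mod-refl))))
        (mod-by-multiple 1ℤ n∣4[αβ+1] (value K β α)))
      where
      shifted : ∀ K α → + 4 * K + + 0 + (+ 4 * α - 1ℤ) ≡ + 4 * (K + α - 1ℤ) + + 3
      shifted = solve-∀
      value : ∀ K β α → ((K + α - 1ℤ) * (+ 4 * β + 1ℤ - 1ℤ) + (+ 4 * β + 1ℤ) + 1ℤ)
                        - (K * (+ 4 * β + 1ℤ - 1ℤ) - 1ℤ - 1ℤ)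
                        ≡ 1ℤ * (+ 4 * (α * β + 1ℤ))
      value = solve-∀
    green-v K 1 _ = commute-via f green blue (vℤ (four K 1)) (f-v K 1 1<4) (f-v (K - α) 2 2<4)
      (trans (alternate-vᵒ -1ℤ A (four-odd₁ K)) (cong vℤ (shifted K α)))
      (at-congruent⇒≡ vℤ vℤ-cong {(K - α) * c + B - A} {K * c + A - B} (green-walk₂ (K - α))
        (trans (cong blue (green-walk₁ K)) (alternate-vᵒ 1ℤ B (even+odd (Kc-even K) A-odd)))
        (mod-by-combination -1ℤ 1ℤ n∣4[αβ+1] n∣8[β-α+1] (value K β α)))
      where
      shifted : ∀ K α → + 4 * K + + 1 - (+ 4 * α - 1ℤ) ≡ + 4 * (K - α) + + 2
      shifted = solve-∀
      value : ∀ K β α → ((K - α) * (+ 4 * β + 1ℤ - 1ℤ) + (+ 4 * β + 1ℤ) - (+ 4 * α - 1ℤ))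
                        - (K * (+ 4 * β + 1ℤ - 1ℤ) + (+ 4 * α - 1ℤ) - (+ 4 * β + 1ℤ))
                        ≡ -1ℤ * (+ 4 * (α * β + 1ℤ)) + 1ℤ * (+ 8 * (β - α + 1ℤ))
      value = solve-∀
    green-v K 2 _ = commute-via f green blue (vℤ (four K 2)) (f-v K 2 2<4) (f-v (K + α) 1 1<4)
      (trans (alternate-vᵉ -1ℤ A (four-even₂ K)) (cong vℤ (shifted K α)))
      (at-congruent⇒≡ vℤ vℤ-cong {(K + α) * c + A} {K * c + B - A + B} (green-walk₁ (K + α))
        (trans (cong blue (green-walk₂ K)) (alternate-vᵉ 1ℤ B (odd+odd (Kc+B-odd K) (neg-odd A-odd))))
        (mod-by-combination 1ℤ -1ℤ n∣4[αβ+1] n∣8[β-α+1] (value K β α)))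
      where
      shifted : ∀ K α → + 4 * K + + 2 + (+ 4 * α - 1ℤ) ≡ + 4 * (K + α) + + 1
      shifted = solve-∀
      value : ∀ K β α → ((K + α) * (+ 4 * β + 1ℤ - 1ℤ) + (+ 4 * α - 1ℤ))
                        - (K * (+ 4 * β + 1ℤ - 1ℤ) + (+ 4 * β + 1ℤ) - (+ 4 * α - 1ℤ) + (+ 4 * β + 1ℤ))
                        ≡ 1ℤ * (+ 4 * (α * β + 1ℤ)) + -1ℤ * (+ 8 * (β - α + 1ℤ))
      value = solve-∀
    green-v K 3 _ = commute-via f green blue (vℤ (four K 3)) (f-v K 3 3<4) (f-v (K - α + 1ℤ) 0 0<4)
      (trans (alternate-vᵒ -1ℤ A (four-odd₃ K)) (cong vℤ (shifted K α)))
      (at-congruent⇒≡ uℤ uℤ-cong {(K - α + 1ℤ) * c - 1ℤ} {K * c + B + 1ℤ + 1ℤ} (green-walk₀ (K - α + 1ℤ))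
        (trans (cong blue (green-walk₃ K)) (alternate-uᵉ 1ℤ B (odd+odd (Kc+B-odd K) mod-refl)))
        (mod-by-multiple -1ℤ n∣4[αβ+1] (value K β α)))
      where
      shifted : ∀ K α → + 4 * K + + 3 - (+ 4 * α - 1ℤ) ≡ + 4 * (K - α + 1ℤ) + + 0
      shifted = solve-∀
      value : ∀ K β α → ((K - α + 1ℤ) * (+ 4 * β + 1ℤ - 1ℤ) - 1ℤ)
                        - (K * (+ 4 * β + 1ℤ - 1ℤ) + (+ 4 * β + 1ℤ) + 1ℤ + 1ℤ)
                        ≡ -1ℤ * (+ 4 * (α * β + 1ℤ))
      value = solve-∀
    green-v K (suc (suc (suc (suc _)))) (ℕ.s≤s (ℕ.s≤s (ℕ.s≤s (ℕ.s≤s ()))))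

    on-u-blocks : (P : V n → Set) → (∀ K r → r ℕ.< 4 → P (uℤ (four K r))) → ∀ i → P (u i)
    on-u-blocks P P-blocks i = subst P (sym (trans (u≡uℤ i) (cong uℤ (sym (four-div-mod (toℕ i))))))
      (P-blocks (+ (toℕ i ℕ./ 4)) (toℕ i ℕ.% 4) (ℕD.m%n<n (toℕ i) 4))

    on-v-blocks : (P : V n → Set) → (∀ K r → r ℕ.< 4 → P (vℤ (four K r))) → ∀ i → P (v i)
    on-v-blocks P P-blocks i = subst P (sym (trans (v≡vℤ i) (cong vℤ (sym (four-div-mod (toℕ i))))))
      (P-blocks (+ (toℕ i ℕ./ 4)) (toℕ i ℕ.% 4) (ℕD.m%n<n (toℕ i) 4))

    f-rotating : Rotating f
    f-rotating = record
      { spoke⇒green = spoke⇒green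
      ; blue⇒spoke = blue⇒spoke
      ; green⇒blue = green⇒blue
      ; fixes-u₀ = trans (f-u 0ℤ 0 0<4) (cong uℤ (ℤP.*-zeroˡ c))
      }
      where
      spoke⇒green : ∀ x → f (spoke x) ≡ green (f x)
      spoke⇒green (u i) = refl
      spoke⇒green (v i) = sym (green-involutive A-odd (f (u i)))
      blue⇒spoke : ∀ x → f (blue x) ≡ spoke (f x)
      blue⇒spoke (u i) = on-u-blocks (λ x → f (blue x) ≡ spoke (f x)) blue-u i
      blue⇒spoke (v i) = on-v-blocks (λ x → f (blue x) ≡ spoke (f x)) blue-v i
      green⇒blue : ∀ x → f (green x) ≡ blue (f x)
      green⇒blue (u i) = on-u-blocks (λ x → f (green x) ≡ blue (f x)) green-u i
      green⇒blue (v i) = on-v-blocks (λ x → f (green x) ≡ blue (f x)) green-v i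

  condition⇒rotating : ∀ {n a b} .{{_ : NonZero n}} → + 4 ∣ + n → RotationCondition n a b →
                       Σ (V n → V n) (Prism.Colouring.Rotating n (+ b) (+ a))
  condition⇒rotating {n} {a} {b} 4∣n cond =
    subst₂ (λ B A → Σ (V n → V n) (Prism.Colouring.Rotating n B A)) (sym +b≡4β+1) (sym +a≡4α-1) (f , f-rotating)
    where
    open RotationCondition cond
    open Construction n 4∣n (+ β) (+ α) n∣4[β²+α] n∣4[αβ+1] n∣8[β-α+1] using (f; f-rotating)
    +b≡4β+1 : + b ≡ + 4 * + β + 1ℤ
    +b≡4β+1 = trans (cong +_ b≡4β+1) (cong (_+ 1ℤ) (ℤP.pos-* 4 β))
    +a≡4α-1 : + a ≡ + 4 * + α - 1ℤ
    +a≡4α-1 = trans (sym (cancel (+ a))) (cong (_- 1ℤ) (trans (cong +_ a+1≡4α) (ℤP.pos-* 4 α)))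
      where
      cancel : ∀ a → a + 1ℤ - 1ℤ ≡ a
      cancel = solve-∀

module Arithmetic where

  open import Data.Nat as ℕ using (ℕ; zero; suc; NonZero)
  import Data.Nat.Properties as ℕP
  import Data.Nat.DivMod as ℕD
  import Data.Nat.Divisibility as ℕ∣
  import Data.Nat.Tactic.RingSolver as ℕSolver
  open import Data.Integer using (ℤ; +_; 1ℤ; _+_; _*_; _-_)
  import Data.Integer.Properties as ℤP
  open import Data.Integer.Divisibility.Signed using (_∣_; divides; ∣-trans; ∣⇒∣ᵤ; ∣ᵤ⇒∣; *-cancelˡ-∣)
  open import Data.Integer.Tactic.RingSolver using (solve-∀)
  open import Data.Product using (Σ; _×_; _,_; proj₁; proj₂)
  open import Data.Sum using (inj₁; inj₂)
  open import Data.Empty using (⊥-elim)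
  open import Relation.Binary.PropositionalEquality
    using (_≡_; refl; sym; trans; cong; subst; subst₂; module ≡-Reasoning)
  open Congruences
  open RotatingMaps using (RotationCondition)

  Characterisation : (n a b : ℕ) .{{_ : NonZero n}} → Set
  Characterisation n a b =
    n ℕ.% 16 ≡ 8 ×
    Σ ℕ λ b₀ → b ≡ 4 ℕ.* b₀ ℕ.+ 1 × b₀ ℕ.% 2 ≡ 1 ×
      n ℕ./ 2 ℕ.< b × 4 ℕ.* b ℕ.+ 4 ℕ.< 3 ℕ.* n ×
      (8 ℕ.* (b₀ ℕ.* b₀ ℕ.+ b₀ ℕ.+ 1)) ℕ.% n ≡ 0 ×
      a ℕ.+ n ℕ./ 2 ≡ b ℕ.+ 2

  <-by-witness : ∀ {m n} k → m ℕ.+ suc k ≡ n → m ℕ.< n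
  <-by-witness {m} k eq = subst (m ℕ.<_) eq (ℕP.m<m+n m (ℕ.s≤s ℕ.z≤n))

  divisor-below-double : ∀ {m k} → m ℕ∣.∣ k → 0 ℕ.< k → k ℕ.< 2 ℕ.* m → k ≡ m
  divisor-below-double (ℕ∣.divides 0 refl) () _
  divisor-below-double {m} (ℕ∣.divides 1 refl) _ _ = ℕP.+-identityʳ m
  divisor-below-double {m} (ℕ∣.divides (suc (suc q)) refl) _ k<2m =
    ⊥-elim (ℕP.<⇒≱ k<2m (ℕP.*-monoˡ-≤ m {2} {suc (suc q)} (ℕ.s≤s (ℕ.s≤s ℕ.z≤n))))

  8*odd%16≡8 : ∀ t → t ℕ.% 2 ≡ 1 → (8 ℕ.* t) ℕ.% 16 ≡ 8
  8*odd%16≡8 t t%2≡1 = begin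
    (8 ℕ.* t) ℕ.% 16                                  ≡⟨ cong (λ s → (8 ℕ.* s) ℕ.% 16) (ℕD.m≡m%n+[m/n]*n t 2) ⟩
    (8 ℕ.* (t ℕ.% 2 ℕ.+ t ℕ./ 2 ℕ.* 2)) ℕ.% 16         ≡⟨ cong (λ r → (8 ℕ.* (r ℕ.+ t ℕ./ 2 ℕ.* 2)) ℕ.% 16) t%2≡1 ⟩
    (8 ℕ.* (1 ℕ.+ t ℕ./ 2 ℕ.* 2)) ℕ.% 16               ≡⟨ cong (ℕ._% 16) (distribute (t ℕ./ 2)) ⟩
    (8 ℕ.+ t ℕ./ 2 ℕ.* 16) ℕ.% 16                     ≡⟨ ℕD.[m+kn]%n≡m%n 8 (t ℕ./ 2) 16 ⟩
    8                                                 ∎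
    where
    open ≡-Reasoning
    distribute : ∀ s → 8 ℕ.* (1 ℕ.+ s ℕ.* 2) ≡ 8 ℕ.+ s ℕ.* 16
    distribute = ℕSolver.solve-∀

  8t/2≡4t : ∀ t → (8 ℕ.* t) ℕ./ 2 ≡ 4 ℕ.* t
  8t/2≡4t t = trans (cong (ℕ._/ 2) (halve t)) (ℕD.m*n/n≡m (4 ℕ.* t) 2)
    where
    halve : ∀ t → 8 ℕ.* t ≡ 4 ℕ.* t ℕ.* 2
    halve = ℕSolver.solve-∀

  pos-8[β²+β+1] : ∀ β → + (8 ℕ.* (β ℕ.* β ℕ.+ β ℕ.+ 1)) ≡ + 8 * (+ β * + β + + β + 1ℤ)
  pos-8[β²+β+1] β = trans (ℤP.pos-* 8 (β ℕ.* β ℕ.+ β ℕ.+ 1)) (cong (+ 8 *_) (trans (ℤP.pos-+ (β ℕ.* β ℕ.+ β) 1)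
    (cong (_+ 1ℤ) (trans (ℤP.pos-+ (β ℕ.* β) β) (cong (_+ + β) (ℤP.pos-* β β))))))

  module FromCondition (α′ d : ℕ) where

    β α t n b a : ℕ
    β = suc α′ ℕ.+ d
    α = suc α′
    t = suc d
    n = 8 ℕ.* t
    b = 4 ℕ.* β ℕ.+ 1
    a = 4 ℕ.* α′ ℕ.+ 3

    t≡β-α+1 : + t ≡ + β - + α + 1ℤ
    t≡β-α+1 = trans (cong +_ (ℕP.+-comm 1 d)) (identity (+ α) (+ d))
      where
      identity : ∀ α d → d + 1ℤ ≡ (α + d) - α + 1ℤ
      identity = solve-∀

    n/2≡4t : n ℕ./ 2 ≡ 4 ℕ.* t
    n/2≡4t = 8t/2≡4t t

    8[β-α+1]≡n : + 8 * (+ β - + α + 1ℤ) ≡ + n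
    8[β-α+1]≡n = trans (cong (+ 8 *_) (sym t≡β-α+1)) (sym (ℤP.pos-* 8 t))

    -- m divides 8t, and 8t < 2 (b + a) < 2m.
    n≡8t : ∀ {m} → b ℕ.+ a ℕ.< m → + m ∣ + 8 * (+ β - + α + 1ℤ) → m ≡ n
    n≡8t {m} b+a<m m∣8[β-α+1] = sym (divisor-below-double (∣⇒∣ᵤ (subst (+ m ∣_) 8[β-α+1]≡n m∣8[β-α+1]))
      (ℕ.s≤s ℕ.z≤n) (ℕP.<-trans (<-by-witness (7 ℕ.+ 16 ℕ.* α′) (identity α′ d)) (ℕP.*-monoʳ-< 2 b+a<m)))
      where
      identity : ∀ α′ d → 8 ℕ.* (1 ℕ.+ d) ℕ.+ (1 ℕ.+ (7 ℕ.+ 16 ℕ.* α′)) ≡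
                 2 ℕ.* ((4 ℕ.* ((1 ℕ.+ α′) ℕ.+ d) ℕ.+ 1) ℕ.+ (4 ℕ.* α′ ℕ.+ 3))
      identity = ℕSolver.solve-∀

    characterisation : ∀ {m} .{{_ : NonZero m}} → m ≡ n → b ℕ.+ a ℕ.< m →
                       + m ∣ + 4 * (+ β * + β + + α) → + m ∣ + 4 * (+ α * + β + 1ℤ) → Characterisation m a b
    characterisation refl b+a<n n∣4[β²+α] n∣4[αβ+1] =
      8*odd%16≡8 t (mod⇒%ℕ≡ t-odd) , β , refl , mod⇒%ℕ≡ β-odd , n/2<b , 4b+4<3n , 8[β²+β+1]%n≡0 , a+n/2≡b+2
      where
      αβ+1-even : Even (+ α * + β + 1ℤ)
      αβ+1-even = mod-by-divisibility (ℤP.+-identityʳ (+ α * + β + 1ℤ))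
        (∣-trans (divides (+ t) (ℤP.*-comm (+ 2) (+ t)))
          (*-cancelˡ-∣ (+ 4) (subst (_∣ + 4 * (+ α * + β + 1ℤ)) 8t≡4[2t] n∣4[αβ+1])))
        where
        8t≡4[2t] : + (8 ℕ.* t) ≡ + 4 * (+ 2 * + t)
        8t≡4[2t] = trans (ℤP.pos-* 8 t) (ℤP.*-assoc (+ 4) (+ 2) (+ t))
      α-odd : Odd (+ α)
      α-odd = odd-factorˡ {+ α} {+ β} (even-suc⇒odd αβ+1-even)
      β-odd : Odd (+ β)
      β-odd = odd-factorʳ {+ α} {+ β} (even-suc⇒odd αβ+1-even)
      t-odd : Odd (+ t)
      t-odd = subst Odd (sym t≡β-α+1) (even+odd (odd+odd β-odd (neg-odd α-odd)) mod-refl)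
      n/2<b : n ℕ./ 2 ℕ.< b
      n/2<b = subst (ℕ._< b) (sym n/2≡4t) (<-by-witness (4 ℕ.* α′) (identity α′ d))
        where
        identity : ∀ α′ d → 4 ℕ.* (1 ℕ.+ d) ℕ.+ (1 ℕ.+ 4 ℕ.* α′) ≡ 4 ℕ.* ((1 ℕ.+ α′) ℕ.+ d) ℕ.+ 1
        identity = ℕSolver.solve-∀
      4b+4<3n : 4 ℕ.* b ℕ.+ 4 ℕ.< 3 ℕ.* n
      4b+4<3n = subst₂ ℕ._<_ (sym (four-b α′ d)) (sym (three-n d))
        (ℕP.+-monoˡ-< (8 ℕ.* t) (ℕP.*-monoʳ-< 2 b+a<n))
        where
        four-b : ∀ α′ d → 4 ℕ.* (4 ℕ.* ((1 ℕ.+ α′) ℕ.+ d) ℕ.+ 1) ℕ.+ 4 ≡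
                 2 ℕ.* ((4 ℕ.* ((1 ℕ.+ α′) ℕ.+ d) ℕ.+ 1) ℕ.+ (4 ℕ.* α′ ℕ.+ 3)) ℕ.+ 8 ℕ.* (1 ℕ.+ d)
        four-b = ℕSolver.solve-∀
        three-n : ∀ d → 3 ℕ.* (8 ℕ.* (1 ℕ.+ d)) ≡ 2 ℕ.* (8 ℕ.* (1 ℕ.+ d)) ℕ.+ 8 ℕ.* (1 ℕ.+ d)
        three-n = ℕSolver.solve-∀
      8[β²+β+1]%n≡0 : (8 ℕ.* (β ℕ.* β ℕ.+ β ℕ.+ 1)) ℕ.% n ≡ 0
      8[β²+β+1]%n≡0 = ℕ∣.n∣m⇒m%n≡0 (8 ℕ.* (β ℕ.* β ℕ.+ β ℕ.+ 1)) n (∣⇒∣ᵤ (subst (+ n ∣_) (sym (pos-8[β²+β+1] β))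
        (∣-combination (+ 2) 1ℤ n∣4[β²+α] n∣8[β-α+1] (identity (+ β) (+ α)))))
        where
        n∣8[β-α+1] : + n ∣ + 8 * (+ β - + α + 1ℤ)
        n∣8[β-α+1] = divides 1ℤ (trans (cong (+ 8 *_) (sym t≡β-α+1))
                       (trans (sym (ℤP.pos-* 8 t)) (sym (ℤP.*-identityˡ (+ n)))))
        identity : ∀ β α → + 8 * (β * β + β + 1ℤ) ≡ + 2 * (+ 4 * (β * β + α)) + 1ℤ * (+ 8 * (β - α + 1ℤ))
        identity = solve-∀
      a+n/2≡b+2 : a ℕ.+ n ℕ./ 2 ≡ b ℕ.+ 2
      a+n/2≡b+2 = trans (cong (a ℕ.+_) n/2≡4t) (identity α′ d)
        where
        identity : ∀ α′ d → 4 ℕ.* α′ ℕ.+ 3 ℕ.+ 4 ℕ.* (1 ℕ.+ d) ≡ 4 ℕ.* ((1 ℕ.+ α′) ℕ.+ d) ℕ.+ 1 ℕ.+ 2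
        identity = ℕSolver.solve-∀

  condition⇒characterisation : ∀ {n a b} .{{_ : NonZero n}} → a ℕ.< b → b ℕ.+ a ℕ.< n →
                               RotationCondition n a b → Characterisation n a b
  condition⇒characterisation {a = a} _ _ record { α = zero ; a+1≡4α = a+1≡0 } =
    ⊥-elim (ℕP.1+n≢0 (trans (ℕP.+-comm 1 a) a+1≡0))
  condition⇒characterisation {n} {a} {b} a<b b+a<n
    record { β = β ; α = suc α′ ; b≡4β+1 = refl ; a+1≡4α = a+1≡4α
           ; n∣4[β²+α] = n∣4[β²+α] ; n∣4[αβ+1] = n∣4[αβ+1] ; n∣8[β-α+1] = n∣8[β-α+1] }
    with ℕP.+-cancelʳ-≡ 1 a (4 ℕ.* α′ ℕ.+ 3) (trans a+1≡4α (regroup α′))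
    where
    regroup : ∀ α′ → 4 ℕ.* (1 ℕ.+ α′) ≡ 4 ℕ.* α′ ℕ.+ 3 ℕ.+ 1
    regroup = ℕSolver.solve-∀
  ... | refl with ℕP.m≤n⇒∃[o]m+o≡n (1+α′≤β a<b)
    where
    1+α′≤β : 4 ℕ.* α′ ℕ.+ 3 ℕ.< 4 ℕ.* β ℕ.+ 1 → suc α′ ℕ.≤ β
    1+α′≤β a<b = ℕP.≤-pred (ℕP.*-cancelˡ-< 4 (suc α′) (suc β)
      (ℕP.≤-<-trans (ℕP.≤-trans (ℕP.≤-reflexive (lower α′)) a<b) (<-by-witness 2 (upper β))))
      where
      lower : ∀ α′ → 4 ℕ.* (1 ℕ.+ α′) ≡ 1 ℕ.+ (4 ℕ.* α′ ℕ.+ 3)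
      lower = ℕSolver.solve-∀
      upper : ∀ β → 4 ℕ.* β ℕ.+ 1 ℕ.+ 3 ≡ 4 ℕ.* (1 ℕ.+ β)
      upper = ℕSolver.solve-∀
  ... | d , refl = FromCondition.characterisation α′ d (FromCondition.n≡8t α′ d b+a<n n∣8[β-α+1])
                     b+a<n n∣4[β²+α] n∣4[αβ+1]

  module FromCharacterisation (T γ : ℕ) {n : ℕ} (n≡8T : n ≡ 8 ℕ.* T) where

    β α : ℕ
    β = T ℕ.+ γ
    α = suc γ

    +n≡8T : + n ≡ + 8 * + T
    +n≡8T = trans (cong +_ n≡8T) (ℤP.pos-* 8 T)

    α≡β+1-T : + α ≡ + β + 1ℤ - + T
    α≡β+1-T = trans (cong +_ (ℕP.+-comm 1 γ)) (identity (+ T) (+ γ))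
      where
      identity : ∀ T γ → γ + 1ℤ ≡ T + γ + 1ℤ - T
      identity = solve-∀

    T∣β²+β+1 : + n ∣ + 8 * (+ β * + β + + β + 1ℤ) → + T ∣ + β * + β + + β + 1ℤ
    T∣β²+β+1 n∣8[β²+β+1] = *-cancelˡ-∣ (+ 8) (subst (_∣ + 8 * (+ β * + β + + β + 1ℤ)) +n≡8T n∣8[β²+β+1])

    module _ (β-odd : Odd (+ β)) (k : ℤ) (β²+β+1≡kT : + β * + β + + β + 1ℤ ≡ k * + T) where

      k-odd : Odd k
      k-odd = odd-factorˡ {k} {+ T} (subst Odd β²+β+1≡kT
        (even+odd (odd+odd (odd*odd β-odd β-odd) β-odd) mod-refl))

      eightfold : ∀ {e} j → e ≡ j * + 2 → + 4 * + T * e ≡ j * + n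
      eightfold {e} j e≡2j = trans (cong (+ 4 * + T *_) e≡2j)
        (trans (reassociate j (+ T)) (cong (j *_) (sym +n≡8T)))
        where
        reassociate : ∀ j T → + 4 * T * (j * + 2) ≡ j * (+ 8 * T)
        reassociate = solve-∀

      n∣4[β²+α] : + n ∣ + 4 * (+ β * + β + + α)
      n∣4[β²+α] with mod⇒∣ k-odd refl
      ... | divides j k-1≡2j = divides j (begin
        + 4 * (+ β * + β + + α)              ≡⟨ cong (λ x → + 4 * (+ β * + β + x)) α≡β+1-T ⟩
        + 4 * (+ β * + β + (+ β + 1ℤ - + T))  ≡⟨ regroup (+ β) (+ T) ⟩
        + 4 * ((+ β * + β + + β + 1ℤ) - + T)  ≡⟨ cong (λ x → + 4 * (x - + T)) β²+β+1≡kT ⟩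
        + 4 * (k * + T - + T)                ≡⟨ factor k (+ T) ⟩
        + 4 * + T * (k - 1ℤ)                 ≡⟨ eightfold j k-1≡2j ⟩
        j * + n                              ∎)
        where
        open ≡-Reasoning
        regroup : ∀ β T → + 4 * (β * β + (β + 1ℤ - T)) ≡ + 4 * ((β * β + β + 1ℤ) - T)
        regroup = solve-∀
        factor : ∀ k T → + 4 * (k * T - T) ≡ + 4 * T * (k - 1ℤ)
        factor = solve-∀

      n∣4[αβ+1] : + n ∣ + 4 * (+ α * + β + 1ℤ)
      n∣4[αβ+1] with mod⇒∣ (odd+odd k-odd (neg-odd β-odd)) refl
      ... | divides j k-β≡2j = divides j (begin
        + 4 * (+ α * + β + 1ℤ)                ≡⟨ cong (λ x → + 4 * (x * + β + 1ℤ)) α≡β+1-T ⟩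
        + 4 * ((+ β + 1ℤ - + T) * + β + 1ℤ)    ≡⟨ regroup (+ β) (+ T) ⟩
        + 4 * ((+ β * + β + + β + 1ℤ) - + T * + β) ≡⟨ cong (λ x → + 4 * (x - + T * + β)) β²+β+1≡kT ⟩
        + 4 * (k * + T - + T * + β)            ≡⟨ factor k (+ T) (+ β) ⟩
        + 4 * + T * (k - + β)                 ≡⟨ eightfold j (trans (sym (ℤP.+-identityʳ (k - + β))) k-β≡2j) ⟩
        j * + n                               ∎)
        where
        open ≡-Reasoning
        regroup : ∀ β T → + 4 * ((β + 1ℤ - T) * β + 1ℤ) ≡ + 4 * ((β * β + β + 1ℤ) - T * β)
        regroup = solve-∀
        factor : ∀ k T β → + 4 * (k * T - T * β) ≡ + 4 * T * (k - β)
        factor = solve-∀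

    rotation-condition : Odd (+ β) → + n ∣ + 8 * (+ β * + β + + β + 1ℤ) →
                         RotationCondition n (4 ℕ.* γ ℕ.+ 3) (4 ℕ.* β ℕ.+ 1)
    rotation-condition β-odd n∣8[β²+β+1] = from-quotient (T∣β²+β+1 n∣8[β²+β+1])
      where
      from-quotient : + T ∣ + β * + β + + β + 1ℤ → RotationCondition n (4 ℕ.* γ ℕ.+ 3) (4 ℕ.* β ℕ.+ 1)
      from-quotient (divides k β²+β+1≡kT) = record
        { β = β
        ; α = α
        ; b≡4β+1 = refl
        ; a+1≡4α = identity γ
        ; n∣4[β²+α] = n∣4[β²+α] β-odd k β²+β+1≡kT
        ; n∣4[αβ+1] = n∣4[αβ+1] β-odd k β²+β+1≡kT
        ; n∣8[β-α+1] = divides 1ℤ (trans (cong (λ x → + 8 * (+ β - x + 1ℤ)) α≡β+1-T)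
                         (trans (cancel (+ β) (+ T)) (sym (trans (ℤP.*-identityˡ (+ n)) +n≡8T))))
        }
        where
        identity : ∀ γ → 4 ℕ.* γ ℕ.+ 3 ℕ.+ 1 ≡ 4 ℕ.* (1 ℕ.+ γ)
        identity = ℕSolver.solve-∀
        cancel : ∀ β T → + 8 * (β - (β + 1ℤ - T) + 1ℤ) ≡ + 8 * T
        cancel = solve-∀

  odd-multiple-of-8 : ∀ n → n ℕ.% 16 ≡ 8 → Σ ℕ λ s → n ≡ 8 ℕ.* suc (2 ℕ.* s)
  odd-multiple-of-8 n n%16≡8 = n ℕ./ 16 , trans (ℕD.m≡m%n+[m/n]*n n 16)
    (trans (cong (ℕ._+ n ℕ./ 16 ℕ.* 16) n%16≡8) (identity (n ℕ./ 16)))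
    where
    identity : ∀ s → 8 ℕ.+ s ℕ.* 16 ≡ 8 ℕ.* (1 ℕ.+ 2 ℕ.* s)
    identity = ℕSolver.solve-∀

  module _ {a T : ℕ} where

    a+4T≡4β+3⇒T≤β : ∀ {β} → a ℕ.+ 4 ℕ.* T ≡ 4 ℕ.* β ℕ.+ 1 ℕ.+ 2 → T ℕ.≤ β
    a+4T≡4β+3⇒T≤β {β} a+4T≡4β+3 = ℕP.≤-pred (ℕP.*-cancelˡ-< 4 T (suc β)
      (ℕP.≤-<-trans (ℕP.m≤n+m (4 ℕ.* T) a) (<-by-witness 0 (trans (cong (ℕ._+ 1) a+4T≡4β+3) (identity β)))))
      where
      identity : ∀ β → 4 ℕ.* β ℕ.+ 1 ℕ.+ 2 ℕ.+ 1 ≡ 4 ℕ.* (1 ℕ.+ β)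
      identity = ℕSolver.solve-∀

    a+4T≡4[T+γ]+3⇒a≡4γ+3 : ∀ {γ} → a ℕ.+ 4 ℕ.* T ≡ 4 ℕ.* (T ℕ.+ γ) ℕ.+ 1 ℕ.+ 2 → a ≡ 4 ℕ.* γ ℕ.+ 3
    a+4T≡4[T+γ]+3⇒a≡4γ+3 {γ} eq = ℕP.+-cancelʳ-≡ (4 ℕ.* T) a (4 ℕ.* γ ℕ.+ 3) (trans eq (identity T γ))
      where
      identity : ∀ T γ → 4 ℕ.* (T ℕ.+ γ) ℕ.+ 1 ℕ.+ 2 ≡ 4 ℕ.* γ ℕ.+ 3 ℕ.+ 4 ℕ.* T
      identity = ℕSolver.solve-∀

  characterisation⇒condition : ∀ {n a b} .{{_ : NonZero n}} → Characterisation n a b →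
                               + 4 ∣ + n × RotationCondition n a b
  characterisation⇒condition {n} {a} (n%16≡8 , b₀ , refl , b₀%2≡1 , _ , _ , 8[b₀²+b₀+1]%n≡0 , a+n/2≡b+2) =
    divides (+ (2 ℕ.* T)) 4∣n , subst₂ (λ a β → RotationCondition n a (4 ℕ.* β ℕ.+ 1)) (sym a≡4γ+3) T+γ≡b₀
      (rotation-condition (%ℕ≡⇒mod (subst (λ β → β ℕ.% 2 ≡ 1) (sym T+γ≡b₀) b₀%2≡1)) n∣8[β²+β+1])
    where
    s T γ : ℕ
    s = proj₁ (odd-multiple-of-8 n n%16≡8)
    T = suc (2 ℕ.* s)
    n≡8T : n ≡ 8 ℕ.* T
    n≡8T = proj₂ (odd-multiple-of-8 n n%16≡8)
    4∣n : + n ≡ + (2 ℕ.* T) * + 4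
    4∣n = trans (cong +_ (trans n≡8T (regroup T))) (ℤP.pos-* (2 ℕ.* T) 4)
      where
      regroup : ∀ T → 8 ℕ.* T ≡ 2 ℕ.* T ℕ.* 4
      regroup = ℕSolver.solve-∀
    a+4T≡4b₀+3 : a ℕ.+ 4 ℕ.* T ≡ 4 ℕ.* b₀ ℕ.+ 1 ℕ.+ 2
    a+4T≡4b₀+3 = trans (cong (a ℕ.+_) (sym (trans (cong (ℕ._/ 2) n≡8T) (8t/2≡4t T)))) a+n/2≡b+2
    γ = proj₁ (ℕP.m≤n⇒∃[o]m+o≡n (a+4T≡4β+3⇒T≤β {a} {T} {b₀} a+4T≡4b₀+3))
    T+γ≡b₀ : T ℕ.+ γ ≡ b₀
    T+γ≡b₀ = proj₂ (ℕP.m≤n⇒∃[o]m+o≡n (a+4T≡4β+3⇒T≤β {a} {T} {b₀} a+4T≡4b₀+3))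
    a≡4γ+3 : a ≡ 4 ℕ.* γ ℕ.+ 3
    a≡4γ+3 = a+4T≡4[T+γ]+3⇒a≡4γ+3 {a} {T}
      (subst (λ β → a ℕ.+ 4 ℕ.* T ≡ 4 ℕ.* β ℕ.+ 1 ℕ.+ 2) (sym T+γ≡b₀) a+4T≡4b₀+3)
    open FromCharacterisation T γ n≡8T using (β; rotation-condition)
    n∣8[β²+β+1] : + n ∣ + 8 * (+ β * + β + + β + 1ℤ)
    n∣8[β²+β+1] = subst (+ n ∣_) (pos-8[β²+β+1] β)
      (∣ᵤ⇒∣ (ℕ∣.m%n≡0⇒n∣m (8 ℕ.* (β ℕ.* β ℕ.+ β ℕ.+ 1)) n
        (subst (λ b₀ → (8 ℕ.* (b₀ ℕ.* b₀ ℕ.+ b₀ ℕ.+ 1)) ℕ.% n ≡ 0) (sym T+γ≡b₀) 8[b₀²+b₀+1]%n≡0)))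

  <∸⇒+< : ∀ {x y z} → x ℕ.< y ℕ.∸ z → x ℕ.+ z ℕ.< y
  <∸⇒+< {x} {y} {z} x<y∸z with ℕP.≤-total z y
  ... | inj₁ z≤y = ℕP.m≤o∸n⇒m+n≤o (suc x) z≤y x<y∸z
  ... | inj₂ y≤z = ⊥-elim (ℕP.n≮0 (subst (x ℕ.<_) (ℕP.m≤n⇒m∸n≡0 y≤z) x<y∸z))

  b∸2<n∸a∸2⇒b+a<n : ∀ {n a b} → 1 ℕ.< a → a ℕ.< b → b ℕ.∸ 2 ℕ.< n ℕ.∸ a ℕ.∸ 2 → b ℕ.+ a ℕ.< n
  b∸2<n∸a∸2⇒b+a<n {n} {a} 1<a a<b gap =
    <∸⇒+< (subst (ℕ._< n ℕ.∸ a) (ℕP.m∸n+n≡m (ℕP.≤-trans 1<a (ℕP.<⇒≤ a<b))) (<∸⇒+< gap))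

open Congruences
open ColouredPrism
open RotatingMaps
open Arithmetic
open import Data.Nat using (ℕ; _+_; _*_; _<_; NonZero)
open import Data.Nat.DivMod using (_%_; _/_)
open import Data.Product using (Σ; _×_; _,_; proj₂; uncurry)
open import Relation.Binary.PropositionalEquality using (_≡_)
open import Function.Bundles using (_↔_; _⇔_; mk⇔)

module Hypotheses (n a b : ℕ) .{{_ : NonZero n}} (n%2≡0 : n % 2 ≡ 0) (a%2≡1 : a % 2 ≡ 1) (b%2≡1 : b % 2 ≡ 1)
                  (a<b : a < b) (b<n : b < n) (v₀vₐ∈G : Gset n a b (W n 0) (W n a)) where

  open ColourClasses n a b (%2≡0⇒2∣ n%2≡0) (%ℕ≡⇒mod a%2≡1) (%ℕ≡⇒mod b%2≡1)
                     (v₀v[a]-green⇒¬CondA a<b b<n a%2≡1 v₀vₐ∈G) public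
  open NecessaryCondition n a b (%2≡0⇒2∣ n%2≡0) (%ℕ≡⇒mod a%2≡1) (%ℕ≡⇒mod b%2≡1) public

proposition7p2 : (n a b : ℕ) .{{_ : NonZero n}} →
    Feasible n a b → 1 < a → Gset n a b (W n 0) (W n a) →
    (Σ (V n ↔ V n) λ φ → CyclicAut n a b φ) ⇔
    (n % 16 ≡ 8 ×
     Σ ℕ λ b₀ → b ≡ 4 * b₀ + 1 × b₀ % 2 ≡ 1 ×
       n / 2 < b × 4 * b + 4 < 3 * n ×
       (8 * (b₀ * b₀ + b₀ + 1)) % n ≡ 0 ×
       a + n / 2 ≡ b + 2)
proposition7p2 n a b (n%2≡0 , _ , a%2≡1 , b%2≡1 , _ , a<b , b<n , _ , _ , _ , _ , _ , gap) 1<a v₀vₐ∈G =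
  mk⇔ (λ φ → condition⇒characterisation a<b (b∸2<n∸a∸2⇒b+a<n 1<a a<b gap)
              (rotating⇒condition (proj₂ (cyclic⇒rotating φ))))
      (λ c → rotating⇒cyclic (uncurry condition⇒rotating (characterisation⇒condition c)))
  where open Hypotheses n a b n%2≡0 a%2≡1 b%2≡1 a<b b<n v₀vₐ∈G
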